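{- For a building set $\mathcal{B}$ on $[n]$, $$f_{\mathcal{P}(\mathcal{B})}(t)=\sum_{S\subseteq[n]}(-t-1)^{n-|S|}f_{\mathcal{P}^{\square}(\mathcal{B}|_S)}(t)\quad\text{and}\quad (t+1)^{|\mathcal{B}_{\max}|}f_{\mathcal{P}(\mathcal{B})}(t)=\sum_{S\subseteq[n]}(-1)^{n-|S|}f_{\mathcal{P}^{\square}(\mathcal{B}|_S)}(t).$$
   Context: A building set on a finite set $X$ is a collection $\mathcal{B}$ of nonempty subsets of $X$ containing all singletons and such that $I\cup J\in\mathcal{B}$ whenever $I,J\in\mathcal{B}$, $I\cap J\neq\varnothing$; $\mathcal{B}_{\max}$ is its set of inclusion-maximal elements; $\mathcal{B}|_S=\{J\in\mathcal{B}:J\subseteq S\}$. A nested collection is a subset $N\subseteq\mathcal{B}\setminus\mathcal{B}_{\max}$ whose members are pairwise nested or disjoint and such that no union of $k\ge2$ pairwise disjoint members lies in $\mathcal{B}$. An extended nested collection is a set $\{I_1,\dots,I_m,x_{i_1},\dots,x_{i_r}\}$ with $I_j\in\mathcal{B}$ (maximal allowed) and formal symbols $x_i$ ($i\in X$) such that the $I_j$ are pairwise nested or disjoint, no union of $k\ge2$ pairwise disjoint $I_j$'s lies in $\mathcal{B}$, and no $i_\ell$ lies in any $I_j$. The nestohedron $\mathcal{P}(\mathcal{B})$ is a simple polytope of dimension $d=|X|-|\mathcal{B}_{\max}|$ whose number $f_i$ of $i$-faces is the number of nested collections of cardinality $d-i$; the extended nestohedron $\mathcal{P}^{\square}(\mathcal{B})$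 is a simple polytope of dimension $|X|$ whose $f_i$ is the number of extended nested collections of cardinality $|X|-i$; for $X=\varnothing$ both are a point. $f_P(t)=\sum_if_it^i$. -}

module Defs where

open import Data.Bool using (Bool; true; false; _∧_; _∨_; not)
open import Data.Nat as ℕ using (ℕ; zero; suc; _∸_; _≡ᵇ_; _≤ᵇ_)
open import Data.Fin using (Fin)
open import Data.Fin.Subset using (Subset; _∩_; _∪_; ⁅_⁆; ∣_∣; ⊥; Nonempty)
open import Data.Vec using (Vec; []; _∷_)
open import Data.List using (cartesianProduct; List; []; _∷_; map; _++_; length; filterᵇ; foldr; upTo)
open import Data.Bool.ListAction using (all; any)
open import Data.Integer as ℤ using (ℤ)
open import Data.Product using (_,_)
open import Relation.Binary.PropositionalEquality using (_≡_)

-- Subsets of [n] = Fin n are represented by Data.Fin.Subset (Vec Bool n).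
-- A family of subsets of [n] (e.g. a building set) is a Boolean membership
-- predicate  Subset n → Bool.

allSubsets : ∀ n → List (Subset n)
allSubsets zero = [] ∷ []
allSubsets (suc n) = map (true ∷_) (allSubsets n) ++ map (false ∷_) (allSubsets n)

-- all sub-collections (sublists) of a list; applied to duplicate-free lists
-- this enumerates each finite subset exactly once
sublists : ∀ {a} {A : Set a} → List A → List (List A)
sublists [] = [] ∷ []
sublists (x ∷ xs) = map (x ∷_) (sublists xs) ++ sublists xs

_⊆ᵇ_ : ∀ {n} → Subset n → Subset n → Bool
[] ⊆ᵇ [] = true
(true ∷ p) ⊆ᵇ (false ∷ q) = false
(_ ∷ p) ⊆ᵇ (_ ∷ q) = p ⊆ᵇ q

isEmptyᵇ : ∀ {n} → Subset n → Bool
isEmptyᵇ [] = true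
isEmptyᵇ (true ∷ p) = false
isEmptyᵇ (false ∷ p) = isEmptyᵇ p

disjointᵇ : ∀ {n} → Subset n → Subset n → Bool
disjointᵇ I J = isEmptyᵇ (I ∩ J)

nestedOrDisjointᵇ : ∀ {n} → Subset n → Subset n → Bool
nestedOrDisjointᵇ I J = (I ⊆ᵇ J) ∨ (J ⊆ᵇ I) ∨ disjointᵇ I J

pairwiseᵇ : ∀ {a} {A : Set a} → (A → A → Bool) → List A → Bool
pairwiseᵇ R [] = true
pairwiseᵇ R (x ∷ xs) = all (R x) xs ∧ pairwiseᵇ R xs

⋃ : ∀ {n} → List (Subset n) → Subset n
⋃ = foldr _∪_ ⊥

record IsBuildingSet {n : ℕ} (B : Subset n → Bool) : Set where
  field
    nonempty     : ∀ J → B J ≡ true → Nonempty J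
    singletons   : ∀ (i : Fin n) → B ⁅ i ⁆ ≡ true
    union-closed : ∀ I J → B I ≡ true → B J ≡ true → Nonempty (I ∩ J) → B (I ∪ J) ≡ true

restrict : ∀ {n} → (Subset n → Bool) → Subset n → (Subset n → Bool)
restrict B S J = B J ∧ (J ⊆ᵇ S)

members : ∀ {n} → (Subset n → Bool) → List (Subset n)
members {n} B = filterᵇ B (allSubsets n)

isMaxᵇ : ∀ {n} → (Subset n → Bool) → Subset n → Bool
isMaxᵇ {n} B J = B J ∧ not (any (λ K → B K ∧ (J ⊆ᵇ K) ∧ not (K ⊆ᵇ J)) (allSubsets n))

maxCount : ∀ {n} → (Subset n → Bool) → ℕ
maxCount {n} B = length (filterᵇ (isMaxᵇ B) (allSubsets n))

noDisjointUnionᵇ : ∀ {n} → (Subset n → Bool) → List (Subset n) → Bool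
noDisjointUnionᵇ B L =
  all (λ M → not ((2 ≤ᵇ length M) ∧ pairwiseᵇ disjointᵇ M ∧ B (⋃ M))) (sublists L)

nestedCondᵇ : ∀ {n} → (Subset n → Bool) → List (Subset n) → Bool
nestedCondᵇ B L = pairwiseᵇ nestedOrDisjointᵇ L ∧ noDisjointUnionᵇ B L

nestedCount : ∀ {n} → (Subset n → Bool) → ℕ → ℕ
nestedCount B k =
  length (filterᵇ (λ L → nestedCondᵇ B L ∧ (length L ≡ᵇ k))
                  (sublists (filterᵇ (λ J → not (isMaxᵇ B J)) (members B))))

-- number of extended nested collections of cardinality k of a building set B
-- on ground set S ⊆ [n] (all members of B assumed ⊆ S): pairs (L , R) with
-- L a collection of members of B (maximal allowed) and R ⊆ S the indices of
-- the formal symbols x_i, none of which lies in any member of L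
extCount : ∀ {n} → (Subset n → Bool) → Subset n → ℕ → ℕ
extCount {n} B S k =
  length (filterᵇ
    (λ { (L , R) → nestedCondᵇ B L ∧ (R ⊆ᵇ S) ∧ all (disjointᵇ R) L
                   ∧ ((length L ℕ.+ ∣ R ∣) ≡ᵇ k) })
    (cartesianProduct (sublists (members B)) (allSubsets n)))

sumℤ : List ℤ → ℤ
sumℤ = foldr ℤ._+_ (ℤ.+ 0)

polyEval : ℕ → (ℕ → ℕ) → ℤ → ℤ
polyEval d c t = sumℤ (map (λ i → ℤ.+ (c i) ℤ.* (t ℤ.^ i)) (upTo (suc d)))

-- f-polynomial of the nestohedron P(B), B a building set on [n]:
-- dimension d = n - |B_max|, f_i = #nested collections of cardinality d - i
fNest : ∀ {n} → (Subset n → Bool) → ℤ → ℤ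
fNest {n} B = polyEval d (λ i → nestedCount B (d ∸ i))
  where d = n ∸ maxCount B

-- f-polynomial of the extended nestohedron P□(B), B a building set on S ⊆ [n]:
-- dimension |S|, f_i = #extended nested collections of cardinality |S| - i
fExt : ∀ {n} → (Subset n → Bool) → Subset n → ℤ → ℤ
fExt B S = polyEval ∣ S ∣ (λ i → extCount B S (∣ S ∣ ∸ i))

-- An extended nested collection of B|_S is a nested collection L of B with ⋃L ⊆ S together with
-- a set R ⊆ S ∖ ⋃L of formal symbols; summing over R (and using |L| ≤ |⋃L|, which holds for
-- nested collections) gives f_{P□(B|_S)}(t) = Σ_{⋃L ⊆ S} t^{|⋃L|-|L|} (t+1)^{|S|-|⋃L|}. Summing
-- a^{n-|S|} times this over all S ⊇ ⋃L by the binomial theorem leaves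
-- Σ_L t^{|⋃L|-|L|} (a+t+1)^{n-|⋃L|}. Split L into its maximal members X ⊆ B_max and the rest C;
-- L is nested iff C is. For a = -1 the summand is t^{n-|X|-|C|}, and summing over X gives
-- (t+1)^{|B_max|} t^{d-|C|}. For a = -t-1 only collections with ⋃L = [n] survive; since a
-- maximal element missed by X would have to lie inside a non-maximal member of C, this forces
-- X = B_max and leaves Σ_C t^{d-|C|} = f_{P(B)}(t).

module Submission where

open import Defs
open import Data.Bool using (Bool; true; false; _∧_; _∨_; not; if_then_else_; T)
open import Data.Bool.Properties using (T-≡; ∧-comm)
import Data.Bool.Properties as Boolₚ
open import Data.Nat as ℕ using (ℕ; zero; suc; _∸_; _≡ᵇ_; _≤ᵇ_; _≤_; _<_; z≤n; s≤s)
import Data.Nat.Properties as ℕₚ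
open import Data.Bool.ListAction using (all; any)
open import Data.Fin using (Fin; zero; suc)
open import Data.Fin.Subset using (Subset; _∩_; _∪_; ∣_∣; ⊥; ⊤; Nonempty; _∈_; _⊆_; _∉_)
import Data.Fin.Subset.Properties as Subsetₚ
open import Data.Vec using ([]; _∷_; here; there)
import Data.Vec.Properties as Vecₚ
open import Data.List using (List; []; _∷_; map; _++_; length; filterᵇ; upTo; cartesianProduct)
import Data.List.Properties as Listₚ
open import Data.List.Membership.Propositional using () renaming (_∈_ to _∈ₗ_; _∉_ to _∉ₗ_)
open import Data.List.Membership.Propositional.Properties
  using (∈-upTo⁻; ∈-++⁺ˡ; ∈-++⁺ʳ; ∈-++⁻; ∈-map⁺; ∈-map⁻; ∈-∃++; ∈-cartesianProduct⁻)
import Data.List.Membership.Propositional.Properties as ∈ₚ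
open import Data.List.Relation.Binary.Sublist.Propositional using ([]; _∷_; _∷ʳ_; ⊆-refl; ⊆-trans) renaming (_⊆_ to _⊑_)
open import Data.List.Relation.Binary.Sublist.Propositional.Properties using (filter-⊆; Any-resp-⊆; All-resp-⊆; ++⁺)
open import Data.List.Relation.Unary.Unique.Propositional using (Unique; []; _∷_)
import Data.List.Relation.Unary.Unique.Propositional.Properties as Uniqueₚ
open import Data.List.Relation.Unary.All using ([])
open import Data.List.Relation.Unary.All.Properties using (All¬⇒¬Any)
open import Data.List.Relation.Unary.Any using (here; there)
open import Data.Integer using (ℤ; +_; _+_; _*_; _^_; -_; _-_; 0ℤ; 1ℤ)
import Data.Integer.Properties as ℤₚ
open import Data.Integer.Tactic.RingSolver using (solve-∀)
open import Data.Product using (_×_; _,_; proj₁; proj₂; ∃)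
open import Data.Sum using (_⊎_; inj₁; inj₂; [_,_]′)
open import Data.Empty using () renaming (⊥ to ⊥₀; ⊥-elim to ⊥₀-elim)
open import Level using (Level)
open import Function using (_∘_; id; Equivalence)
open import Relation.Nullary using (¬_; yes; no; contradiction)
open import Relation.Nullary.Decidable using (T?)
open import Relation.Binary.Definitions using (DecidableEquality)
open import Relation.Binary.PropositionalEquality using (_≡_; _≢_; refl; sym; trans; cong; cong₂; subst; module ≡-Reasoning)

private variable
  a b : Level
  A : Set a
  B : Set b
  n : ℕ

true≢false : true ≢ false
true≢false ()

∧-true⁻ : ∀ {b c} → b ∧ c ≡ true → b ≡ true × c ≡ true
∧-true⁻ {true} {true} _ = refl , refl

not-true⁻ : ∀ {b} → not b ≡ true → b ≡ false
not-true⁻ {false} _ = refl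

not-false⁻ : ∀ {b} → not b ≡ false → b ≡ true
not-false⁻ {true} _ = refl

∸-split : ∀ {a b c} → a ≤ b → b ≤ c → c ∸ a ≡ (b ∸ a) ℕ.+ (c ∸ b)
∸-split {a} {b} {c} a≤b b≤c = begin
  c ∸ a                   ≡⟨ cong (_∸ a) (sym (ℕₚ.m∸n+n≡m b≤c)) ⟩
  ((c ∸ b) ℕ.+ b) ∸ a     ≡⟨ ℕₚ.+-∸-assoc (c ∸ b) a≤b ⟩
  (c ∸ b) ℕ.+ (b ∸ a)     ≡⟨ ℕₚ.+-comm (c ∸ b) (b ∸ a) ⟩
  (b ∸ a) ℕ.+ (c ∸ b)     ∎
  where open ≡-Reasoning

≡ᵇ-refl : ∀ m → (m ≡ᵇ m) ≡ true
≡ᵇ-refl m = Equivalence.to T-≡ (ℕₚ.≡⇒≡ᵇ m m refl)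

≢⇒≡ᵇ-false : ∀ {m n} → m ≢ n → (m ≡ᵇ n) ≡ false
≢⇒≡ᵇ-false {m} {n} m≢n with m ≡ᵇ n in m≡ᵇn
... | false = refl
... | true = contradiction (ℕₚ.≡ᵇ⇒≡ m n (Equivalence.from T-≡ m≡ᵇn)) m≢n

1+m∸k≡1+[m∸k] : ∀ {m k} → k ≤ m → suc m ∸ k ≡ suc (m ∸ k)
1+m∸k≡1+[m∸k] = ℕₚ.+-∸-assoc 1

∸-comm : ∀ N a b → (N ∸ a) ∸ b ≡ (N ∸ b) ∸ a
∸-comm N a b = trans (ℕₚ.∸-+-assoc N a b) (trans (cong (N ∸_) (ℕₚ.+-comm a b)) (sym (ℕₚ.∸-+-assoc N b a)))

exponent-shift : ∀ {N} x c m → c ℕ.+ m ≤ N → N ∸ (x ℕ.+ c) ≡ (((N ∸ m) ∸ c) ℕ.+ m) ∸ x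
exponent-shift {N} x c m c+m≤N = begin
  N ∸ (x ℕ.+ c)                ≡⟨ cong (N ∸_) (ℕₚ.+-comm x c) ⟩
  N ∸ (c ℕ.+ x)                ≡⟨ sym (ℕₚ.∸-+-assoc N c x) ⟩
  (N ∸ c) ∸ x                  ≡⟨ cong (_∸ x) (sym (ℕₚ.m∸n+n≡m m≤N∸c)) ⟩
  (((N ∸ c) ∸ m) ℕ.+ m) ∸ x    ≡⟨ cong (λ k → (k ℕ.+ m) ∸ x) (∸-comm N c m) ⟩
  (((N ∸ m) ∸ c) ℕ.+ m) ∸ x    ∎
  where
  open ≡-Reasoning
  m≤N∸c : m ≤ N ∸ c
  m≤N∸c = ℕₚ.m+n≤o⇒m≤o∸n m (subst (_≤ N) (ℕₚ.+-comm c m) c+m≤N)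

-- Sums of integers over lists

∑ : List A → (A → ℤ) → ℤ
∑ xs f = sumℤ (map f xs)

ind : Bool → ℤ → ℤ
ind b z = if b then z else 0ℤ

∑-++ : ∀ xs ys (f : A → ℤ) → ∑ (xs ++ ys) f ≡ ∑ xs f + ∑ ys f
∑-++ [] ys f = sym (ℤₚ.+-identityˡ _)
∑-++ (x ∷ xs) ys f = trans (cong (_+_ (f x)) (∑-++ xs ys f)) (sym (ℤₚ.+-assoc (f x) _ _))

∑-cong-∈ : ∀ xs {f g : A → ℤ} → (∀ {x} → x ∈ₗ xs → f x ≡ g x) → ∑ xs f ≡ ∑ xs g
∑-cong-∈ [] h = refl
∑-cong-∈ (x ∷ xs) h = cong₂ _+_ (h (here refl)) (∑-cong-∈ xs (h ∘ there))

∑-cong : ∀ xs {f g : A → ℤ} → (∀ x → f x ≡ g x) → ∑ xs f ≡ ∑ xs g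
∑-cong xs h = ∑-cong-∈ xs (λ {x} _ → h x)

∑-zero : ∀ xs → ∑ xs (λ (_ : A) → 0ℤ) ≡ 0ℤ
∑-zero [] = refl
∑-zero (x ∷ xs) = trans (ℤₚ.+-identityˡ _) (∑-zero xs)

∑-vanishes : ∀ xs {f : A → ℤ} → (∀ {x} → x ∈ₗ xs → f x ≡ 0ℤ) → ∑ xs f ≡ 0ℤ
∑-vanishes xs h = trans (∑-cong-∈ xs h) (∑-zero xs)

∑-+ : ∀ xs (f g : A → ℤ) → ∑ xs (λ x → f x + g x) ≡ ∑ xs f + ∑ xs g
∑-+ [] f g = refl
∑-+ (x ∷ xs) f g = trans (cong (_+_ (f x + g x)) (∑-+ xs f g)) (+-interchange (f x) (g x) _ _)
  where
  +-interchange : ∀ a b c d → a + b + (c + d) ≡ a + c + (b + d)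
  +-interchange = solve-∀

∑-*ˡ : ∀ xs c (f : A → ℤ) → ∑ xs (λ x → c * f x) ≡ c * ∑ xs f
∑-*ˡ [] c f = sym (ℤₚ.*-zeroʳ c)
∑-*ˡ (x ∷ xs) c f = trans (cong (_+_ (c * f x)) (∑-*ˡ xs c f)) (sym (ℤₚ.*-distribˡ-+ c (f x) _))

∑-*ʳ : ∀ xs c (f : A → ℤ) → ∑ xs (λ x → f x * c) ≡ ∑ xs f * c
∑-*ʳ xs c f = trans (∑-cong xs (λ x → ℤₚ.*-comm (f x) c)) (trans (∑-*ˡ xs c f) (ℤₚ.*-comm c _))

∑-ind : ∀ xs b (f : A → ℤ) → ∑ xs (λ x → ind b (f x)) ≡ ind b (∑ xs f)
∑-ind xs true f = refl
∑-ind xs false f = ∑-zero xs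

∑-filterᵇ : ∀ xs (p : A → Bool) (f : A → ℤ) → ∑ (filterᵇ p xs) f ≡ ∑ xs (λ x → ind (p x) (f x))
∑-filterᵇ [] p f = refl
∑-filterᵇ (x ∷ xs) p f with p x
... | true = cong (_+_ (f x)) (∑-filterᵇ xs p f)
... | false = trans (∑-filterᵇ xs p f) (sym (ℤₚ.+-identityˡ _))

length-filterᵇ : ∀ xs (p : A → Bool) → + length (filterᵇ p xs) ≡ ∑ xs (λ x → ind (p x) 1ℤ)
length-filterᵇ [] p = refl
length-filterᵇ (x ∷ xs) p with p x
... | true = trans (ℤₚ.pos-+ 1 _) (cong (_+_ (1ℤ)) (length-filterᵇ xs p))
... | false = trans (length-filterᵇ xs p) (sym (ℤₚ.+-identityˡ _))

∑-map : (xs : List A) (g : A → B) (f : B → ℤ) → ∑ (map g xs) f ≡ ∑ xs (f ∘ g)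
∑-map xs g f = cong sumℤ (sym (Listₚ.map-∘ xs))

∑-comm : ∀ xs ys (f : A → B → ℤ) → ∑ xs (λ x → ∑ ys (f x)) ≡ ∑ ys (λ y → ∑ xs (λ x → f x y))
∑-comm [] ys f = sym (∑-zero ys)
∑-comm (x ∷ xs) ys f = trans (cong (_+_ (∑ ys (f x))) (∑-comm xs ys f)) (sym (∑-+ ys (f x) _))

∑-cartesianProduct : ∀ xs ys (f : A × B → ℤ) →
  ∑ (cartesianProduct xs ys) f ≡ ∑ xs (λ x → ∑ ys (λ y → f (x , y)))
∑-cartesianProduct [] ys f = refl
∑-cartesianProduct (x ∷ xs) ys f =
  trans (∑-++ (map (x ,_) ys) _ f) (cong₂ _+_ (∑-map ys (x ,_) f) (∑-cartesianProduct xs ys f))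

ind-∧ : ∀ b c z → ind (b ∧ c) z ≡ ind b (ind c z)
ind-∧ true c z = refl
ind-∧ false c z = refl

ind-*ʳ : ∀ b z w → ind b z * w ≡ ind b (z * w)
ind-*ʳ true z w = refl
ind-*ʳ false z w = refl

ind-*ˡ : ∀ b c z → ind b (c * z) ≡ c * ind b z
ind-*ˡ true c z = refl
ind-*ˡ false c z = sym (ℤₚ.*-zeroʳ c)

zero-power-selects : ∀ (t : ℤ) {u m} → u ≤ m → ∀ l → t ^ (u ∸ l) * 0ℤ ^ (m ∸ u) ≡ ind (u ≡ᵇ m) (t ^ (m ∸ l))
zero-power-selects t {u} {m} u≤m l with u ℕ.≟ m
... | yes refl rewrite ℕₚ.n∸n≡0 u | ≡ᵇ-refl u = ℤₚ.*-identityʳ (t ^ (u ∸ l))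
... | no u≢m = begin
  t ^ (u ∸ l) * 0ℤ ^ (m ∸ u)        ≡⟨ cong (t ^ (u ∸ l) *_) (0^-positive (ℕₚ.m<n⇒0<n∸m (ℕₚ.≤∧≢⇒< u≤m u≢m))) ⟩
  t ^ (u ∸ l) * 0ℤ                  ≡⟨ ℤₚ.*-zeroʳ (t ^ (u ∸ l)) ⟩
  0ℤ                                ≡⟨ cong (λ b → ind b (t ^ (m ∸ l))) (sym (≢⇒≡ᵇ-false u≢m)) ⟩
  ind (u ≡ᵇ m) (t ^ (m ∸ l))        ∎
  where
  open ≡-Reasoning
  0^-positive : ∀ {k} → 0 < k → 0ℤ ^ k ≡ 0ℤ
  0^-positive {suc k} _ = ℤₚ.*-zeroˡ (0ℤ ^ k)

∑-upTo-∷ʳ : ∀ m (f : ℕ → ℤ) → ∑ (upTo (suc m)) f ≡ ∑ (upTo m) f + f m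
∑-upTo-∷ʳ m f = begin
  ∑ (upTo (suc m)) f             ≡⟨ cong (λ l → ∑ l f) (sym (Listₚ.upTo-∷ʳ m)) ⟩
  ∑ (upTo m ++ m ∷ []) f         ≡⟨ ∑-++ (upTo m) (m ∷ []) f ⟩
  ∑ (upTo m) f + (f m + 0ℤ)      ≡⟨ cong (_+_ (∑ (upTo m) f)) (ℤₚ.+-identityʳ (f m)) ⟩
  ∑ (upTo m) f + f m             ∎
  where open ≡-Reasoning

∑-upTo-single : ∀ m (f : ℕ → ℤ) {k} → k < m → (∀ {i} → i < m → i ≢ k → f i ≡ 0ℤ) → ∑ (upTo m) f ≡ f k
∑-upTo-single (suc m) f {k} k<1+m vanish with k ℕ.≟ m
... | yes refl = begin
  ∑ (upTo (suc k)) f   ≡⟨ ∑-upTo-∷ʳ k f ⟩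
  ∑ (upTo k) f + f k   ≡⟨ cong (_+ f k) (∑-vanishes (upTo k) λ i∈ →
                            vanish (ℕₚ.m<n⇒m<1+n (∈-upTo⁻ i∈)) (ℕₚ.<⇒≢ (∈-upTo⁻ i∈))) ⟩
  0ℤ + f k             ≡⟨ ℤₚ.+-identityˡ (f k) ⟩
  f k                  ∎
  where open ≡-Reasoning
... | no k≢m = begin
  ∑ (upTo (suc m)) f   ≡⟨ ∑-upTo-∷ʳ m f ⟩
  ∑ (upTo m) f + f m   ≡⟨ cong₂ _+_ (∑-upTo-single m f k<m (vanish ∘ ℕₚ.m<n⇒m<1+n)) (vanish ℕₚ.≤-refl (k≢m ∘ sym)) ⟩
  f k + 0ℤ             ≡⟨ ℤₚ.+-identityʳ (f k) ⟩
  f k                  ∎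
  where
  open ≡-Reasoning
  k<m : k < m
  k<m = ℕₚ.≤∧≢⇒< (ℕₚ.≤-pred k<1+m) k≢m

∑-upTo-monomial : ∀ (t : ℤ) {d w} → w ≤ d → ∑ (upTo (suc d)) (λ i → ind (w ≡ᵇ d ∸ i) (t ^ i)) ≡ t ^ (d ∸ w)
∑-upTo-monomial t {d} {w} w≤d = begin
  ∑ (upTo (suc d)) (λ i → ind (w ≡ᵇ d ∸ i) (t ^ i))
    ≡⟨ ∑-upTo-single (suc d) _ (s≤s (ℕₚ.m∸n≤m d w)) off-diagonal ⟩
  ind (w ≡ᵇ d ∸ (d ∸ w)) (t ^ (d ∸ w))
    ≡⟨ cong (λ v → ind (w ≡ᵇ v) (t ^ (d ∸ w))) (ℕₚ.m∸[m∸n]≡n w≤d) ⟩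
  ind (w ≡ᵇ w) (t ^ (d ∸ w))
    ≡⟨ cong (λ b → ind b (t ^ (d ∸ w))) (≡ᵇ-refl w) ⟩
  t ^ (d ∸ w) ∎
  where
  open ≡-Reasoning
  off-diagonal : ∀ {i} → i < suc d → i ≢ d ∸ w → ind (w ≡ᵇ d ∸ i) (t ^ i) ≡ 0ℤ
  off-diagonal {i} i<1+d i≢ = cong (λ b → ind b (t ^ i)) (≢⇒≡ᵇ-false {w} {d ∸ i} λ w≡d∸i →
    i≢ (trans (sym (ℕₚ.m∸[m∸n]≡n (ℕₚ.≤-pred i<1+d))) (cong (d ∸_) (sym w≡d∸i))))

polyEval-count : (d : ℕ) (t : ℤ) (xs : List A) (P : A → Bool) (w : A → ℕ) (c : ℕ → ℕ) →
  (∀ k → c k ≡ length (filterᵇ (λ x → P x ∧ (w x ≡ᵇ k)) xs)) →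
  (∀ {x} → x ∈ₗ xs → P x ≡ true → w x ≤ d) →
  polyEval d (λ i → c (d ∸ i)) t ≡ ∑ xs (λ x → ind (P x) (t ^ (d ∸ w x)))
polyEval-count d t xs P w c c≡ w≤d = begin
  ∑ (upTo (suc d)) (λ i → + c (d ∸ i) * t ^ i)
    ≡⟨ ∑-cong (upTo (suc d)) (λ i → trans (cong (λ m → + m * t ^ i) (c≡ (d ∸ i)))
                                   (trans (cong (_* t ^ i) (length-filterᵇ xs _)) (sym (∑-*ʳ xs (t ^ i) _)))) ⟩
  ∑ (upTo (suc d)) (λ i → ∑ xs (λ x → ind (P x ∧ (w x ≡ᵇ d ∸ i)) 1ℤ * t ^ i))
    ≡⟨ sym (∑-comm xs (upTo (suc d)) _) ⟩
  ∑ xs (λ x → ∑ (upTo (suc d)) (λ i → ind (P x ∧ (w x ≡ᵇ d ∸ i)) 1ℤ * t ^ i))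
    ≡⟨ ∑-cong-∈ xs per-element ⟩
  ∑ xs (λ x → ind (P x) (t ^ (d ∸ w x))) ∎
  where
  open ≡-Reasoning
  per-element : ∀ {x} → x ∈ₗ xs →
    ∑ (upTo (suc d)) (λ i → ind (P x ∧ (w x ≡ᵇ d ∸ i)) 1ℤ * t ^ i) ≡ ind (P x) (t ^ (d ∸ w x))
  per-element {x} x∈ with P x in Px
  ... | false = ∑-zero (upTo (suc d))
  ... | true = trans (∑-cong (upTo (suc d)) (λ i → trans (ind-*ʳ (w x ≡ᵇ d ∸ i) 1ℤ (t ^ i))
                                                  (cong (ind (w x ≡ᵇ d ∸ i)) (ℤₚ.*-identityˡ (t ^ i)))))
                     (∑-upTo-monomial t (w≤d x∈ Px))

∈-resp-⊑ : ∀ {x : A} {xs ys} → xs ⊑ ys → x ∈ₗ xs → x ∈ₗ ys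
∈-resp-⊑ = Any-resp-⊆

Unique-resp-⊑ : ∀ {xs ys : List A} → xs ⊑ ys → Unique ys → Unique xs
Unique-resp-⊑ [] u = u
Unique-resp-⊑ (_ ∷ʳ s) (_ ∷ u) = Unique-resp-⊑ s u
Unique-resp-⊑ (refl ∷ s) (x≢ ∷ u) = All-resp-⊆ s x≢ ∷ Unique-resp-⊑ s u

Unique-∉-middle : ∀ xs {x : A} {ys} → Unique (xs ++ x ∷ ys) → x ∉ₗ xs × x ∉ₗ ys
Unique-∉-middle [] (x≢ ∷ _) = (λ ()) , All¬⇒¬Any x≢
Unique-∉-middle (z ∷ xs) (z≢ ∷ u) with x∉xs , x∉ys ← Unique-∉-middle xs u = x∉z∷xs , x∉ys
  where
  x∉z∷xs : _ ∉ₗ z ∷ xs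
  x∉z∷xs (here refl) = All¬⇒¬Any z≢ (∈-++⁺ʳ xs (here refl))
  x∉z∷xs (there x∈xs) = x∉xs x∈xs

++-∷-⊒ : ∀ (ys : List A) x zs → ys ++ zs ⊑ ys ++ x ∷ zs
++-∷-⊒ ys x zs = ++⁺ ⊆-refl (x ∷ʳ ⊆-refl)

length-++-∷ : ∀ (ys : List A) x zs → length (ys ++ x ∷ zs) ≡ suc (length (ys ++ zs))
length-++-∷ [] x zs = refl
length-++-∷ (y ∷ ys) x zs = cong suc (length-++-∷ ys x zs)

∈-filterᵇ⁻ : ∀ (p : A → Bool) xs {x} → x ∈ₗ filterᵇ p xs → x ∈ₗ xs × p x ≡ true
∈-filterᵇ⁻ p xs x∈ with x∈xs , px ← ∈ₚ.∈-filter⁻ (T? ∘ p) x∈ = x∈xs , Equivalence.to T-≡ px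

∈-filterᵇ⁺ : ∀ (p : A → Bool) {x xs} → x ∈ₗ xs → p x ≡ true → x ∈ₗ filterᵇ p xs
∈-filterᵇ⁺ p x∈xs px = ∈ₚ.∈-filter⁺ (T? ∘ p) x∈xs (Equivalence.from T-≡ px)

all⁻ : ∀ (p : A → Bool) {x} xs → all p xs ≡ true → x ∈ₗ xs → p x ≡ true
all⁻ p (y ∷ xs) h x∈ with p y in py | x∈
... | true | here refl = py
... | true | there x∈xs = all⁻ p xs h x∈xs

all⁺ : ∀ (p : A → Bool) xs → (∀ {x} → x ∈ₗ xs → p x ≡ true) → all p xs ≡ true
all⁺ p [] h = refl
all⁺ p (y ∷ xs) h rewrite h (here refl) = all⁺ p xs (h ∘ there)

all-cong-∈ : ∀ (f g : A → Bool) xs → (∀ {x} → x ∈ₗ xs → f x ≡ g x) → all f xs ≡ all g xs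
all-cong-∈ f g [] h = refl
all-cong-∈ f g (x ∷ xs) h = cong₂ _∧_ (h (here refl)) (all-cong-∈ f g xs (h ∘ there))

all-++ : ∀ (p : A → Bool) xs ys → all p (xs ++ ys) ≡ all p xs ∧ all p ys
all-++ p [] ys = refl
all-++ p (x ∷ xs) ys with p x
... | true = all-++ p xs ys
... | false = refl

any-false⁻ : ∀ (p : A → Bool) {x} xs → any p xs ≡ false → x ∈ₗ xs → p x ≡ false
any-false⁻ p (y ∷ xs) h x∈ with p y in py | x∈
... | false | here refl = py
... | false | there x∈xs = any-false⁻ p xs h x∈xs

any-false⁺ : ∀ (p : A → Bool) xs → (∀ {x} → x ∈ₗ xs → p x ≡ false) → any p xs ≡ false
any-false⁺ p [] h = refl
any-false⁺ p (y ∷ xs) h rewrite h (here refl) = any-false⁺ p xs (h ∘ there)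

any-true⁺ : ∀ (p : A → Bool) {x} xs → x ∈ₗ xs → p x ≡ true → any p xs ≡ true
any-true⁺ p (y ∷ xs) (here refl) px rewrite px = refl
any-true⁺ p (y ∷ xs) (there x∈xs) px with p y
... | true = refl
... | false = any-true⁺ p xs x∈xs px

any-true⁻ : ∀ (p : A → Bool) xs → any p xs ≡ true → ∃ λ x → x ∈ₗ xs × p x ≡ true
any-true⁻ p (y ∷ xs) h with p y in py
... | true = y , here refl , py
... | false with x , x∈xs , px ← any-true⁻ p xs h = x , there x∈xs , px

pairwiseᵇ⁻ : ∀ (R : A → A → Bool) L {x y} → pairwiseᵇ R L ≡ true → x ∈ₗ L → y ∈ₗ L → x ≢ y →
  R x y ≡ true ⊎ R y x ≡ true
pairwiseᵇ⁻ R (z ∷ L) h x∈ y∈ x≢y with all (R z) L in Rz | x∈ | y∈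
... | true | here refl | here refl = ⊥₀-elim (x≢y refl)
... | true | here refl | there y∈L = inj₁ (all⁻ (R z) L Rz y∈L)
... | true | there x∈L | here refl = inj₂ (all⁻ (R z) L Rz x∈L)
... | true | there x∈L | there y∈L = pairwiseᵇ⁻ R L h x∈L y∈L x≢y

pairwiseᵇ⁺ : ∀ (R : A → A → Bool) L → Unique L → (∀ {x y} → x ∈ₗ L → y ∈ₗ L → x ≢ y → R x y ≡ true) →
  pairwiseᵇ R L ≡ true
pairwiseᵇ⁺ R [] _ h = refl
pairwiseᵇ⁺ R (z ∷ L) (z≢ ∷ u) h
  rewrite all⁺ (R z) L (λ y∈L → h (here refl) (there y∈L) (λ { refl → All¬⇒¬Any z≢ y∈L }))
  = pairwiseᵇ⁺ R L u (λ x∈L y∈L → h (there x∈L) (there y∈L))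

pairwiseᵇ-partner : ∀ (R : A → A → Bool) M {x} → pairwiseᵇ R M ≡ true → x ∈ₗ M → 2 ≤ length M →
  ∃ λ y → y ∈ₗ M × (R x y ≡ true ⊎ R y x ≡ true)
pairwiseᵇ-partner R (z ∷ []) h (here refl) (s≤s ())
pairwiseᵇ-partner R (z ∷ w ∷ M) h (here refl) _ with all (R z) (w ∷ M) in Rz
... | true = w , there (here refl) , inj₁ (all⁻ (R z) (w ∷ M) Rz (here refl))
pairwiseᵇ-partner R (z ∷ M) h (there x∈M) _ with all (R z) M in Rz
... | true = z , here refl , inj₂ (all⁻ (R z) M Rz x∈M)

pairwiseᵇ-resp-⊑ : ∀ (R : A → A → Bool) {M L} → M ⊑ L → pairwiseᵇ R L ≡ true → pairwiseᵇ R M ≡ true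
pairwiseᵇ-resp-⊑ R [] h = h
pairwiseᵇ-resp-⊑ R {L = y ∷ L} (_ ∷ʳ s) h with all (R y) L
... | true = pairwiseᵇ-resp-⊑ R s h
pairwiseᵇ-resp-⊑ R {x ∷ M} {x ∷ L} (refl ∷ s) h with all (R x) L in Rx
... | true rewrite all⁺ (R x) M (all⁻ (R x) L Rx ∘ ∈-resp-⊑ s) = pairwiseᵇ-resp-⊑ R s h

filterᵇ-cong : ∀ (p q : A → Bool) xs → (∀ x → p x ≡ q x) → filterᵇ p xs ≡ filterᵇ q xs
filterᵇ-cong p q [] h = refl
filterᵇ-cong p q (x ∷ xs) h rewrite h x with q x
... | true = cong (x ∷_) (filterᵇ-cong p q xs h)
... | false = filterᵇ-cong p q xs h

filterᵇ-accept : ∀ (p : A → Bool) {x} xs → p x ≡ true → filterᵇ p (x ∷ xs) ≡ x ∷ filterᵇ p xs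
filterᵇ-accept p xs px rewrite px = refl

filterᵇ-reject : ∀ (p : A → Bool) {x} xs → p x ≡ false → filterᵇ p (x ∷ xs) ≡ filterᵇ p xs
filterᵇ-reject p xs px rewrite px = refl

filterᵇ-none : ∀ (p : A → Bool) xs → (∀ {x} → x ∈ₗ xs → p x ≡ false) → filterᵇ p xs ≡ []
filterᵇ-none p [] h = refl
filterᵇ-none p (x ∷ xs) h rewrite h (here refl) = filterᵇ-none p xs (h ∘ there)

filterᵇ-all : ∀ (p : A → Bool) xs → (∀ {x} → x ∈ₗ xs → p x ≡ true) → filterᵇ p xs ≡ xs
filterᵇ-all p [] h = refl
filterᵇ-all p (x ∷ xs) h rewrite h (here refl) = cong (x ∷_) (filterᵇ-all p xs (h ∘ there))

filterᵇ-filterᵇ : ∀ (p q : A → Bool) xs → (∀ {x} → q x ≡ true → p x ≡ true) →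
  filterᵇ q (filterᵇ p xs) ≡ filterᵇ q xs
filterᵇ-filterᵇ p q [] h = refl
filterᵇ-filterᵇ p q (x ∷ xs) h with p x in px | q x in qx
... | true | true rewrite qx = cong (x ∷_) (filterᵇ-filterᵇ p q xs h)
... | true | false rewrite qx = filterᵇ-filterᵇ p q xs h
... | false | true with () ← trans (sym (h qx)) px
... | false | false = filterᵇ-filterᵇ p q xs h

filterᵇ-∧ : ∀ (p q : A → Bool) xs → filterᵇ (λ x → p x ∧ q x) xs ≡ filterᵇ q (filterᵇ p xs)
filterᵇ-∧ p q [] = refl
filterᵇ-∧ p q (x ∷ xs) with p x
... | false = filterᵇ-∧ p q xs
... | true with q x
... | true = cong (x ∷_) (filterᵇ-∧ p q xs)
... | false = filterᵇ-∧ p q xs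

length-partitionᵇ : ∀ (p : A → Bool) xs → length xs ≡ length (filterᵇ p xs) ℕ.+ length (filterᵇ (not ∘ p) xs)
length-partitionᵇ p [] = refl
length-partitionᵇ p (x ∷ xs) with p x
... | true = cong suc (length-partitionᵇ p xs)
... | false = trans (cong suc (length-partitionᵇ p xs)) (sym (ℕₚ.+-suc _ _))

argmax : ∀ (f : A → ℕ) xs {x} → x ∈ₗ xs → ∃ λ y → y ∈ₗ xs × (∀ {z} → z ∈ₗ xs → f z ≤ f y)
argmax f (w ∷ []) _ = w , here refl , λ { (here refl) → ℕₚ.≤-refl }
argmax f (w ∷ v ∷ xs) _ with y , y∈ , y-max ← argmax f (v ∷ xs) (here refl) | f w ℕ.≤? f y
... | yes fw≤fy = y , there y∈ , λ { (here refl) → fw≤fy ; (there z∈) → y-max z∈ }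
... | no fw≰fy = w , here refl , λ where
  (here refl) → ℕₚ.≤-refl
  (there z∈) → ℕₚ.≤-trans (y-max z∈) (ℕₚ.<⇒≤ (ℕₚ.≰⇒> fw≰fy))

sublists⁻ : ∀ {M : List A} L → M ∈ₗ sublists L → M ⊑ L
sublists⁻ [] (here refl) = []
sublists⁻ (x ∷ L) M∈ with ∈-++⁻ (map (x ∷_) (sublists L)) M∈
... | inj₁ M∈₁ with _ , M'∈ , refl ← ∈-map⁻ (x ∷_) M∈₁ = refl ∷ sublists⁻ L M'∈
... | inj₂ M∈₂ = x ∷ʳ sublists⁻ L M∈₂

sublists⁺ : ∀ {M L : List A} → M ⊑ L → M ∈ₗ sublists L
sublists⁺ [] = here refl
sublists⁺ (_∷ʳ_ {ys = L} x s) = ∈-++⁺ʳ (map (x ∷_) (sublists L)) (sublists⁺ s)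
sublists⁺ (refl ∷ s) = ∈-++⁺ˡ (∈-map⁺ _ (sublists⁺ s))

all-map-∷ : ∀ (g : List A → Bool) x Ms → all g (map (x ∷_) Ms) ≡ all (λ M → g (x ∷ M)) Ms
all-map-∷ g x [] = refl
all-map-∷ g x (M ∷ Ms) = cong (g (x ∷ M) ∧_) (all-map-∷ g x Ms)

filterᵇ-map-∷ : ∀ (g : List A → Bool) x Ms →
  filterᵇ g (map (x ∷_) Ms) ≡ map (x ∷_) (filterᵇ (λ M → g (x ∷ M)) Ms)
filterᵇ-map-∷ g x [] = refl
filterᵇ-map-∷ g x (M ∷ Ms) with g (x ∷ M)
... | true = cong ((x ∷ M) ∷_) (filterᵇ-map-∷ g x Ms)
... | false = filterᵇ-map-∷ g x Ms

sublists-filterᵇ : ∀ (p : A → Bool) xs → sublists (filterᵇ p xs) ≡ filterᵇ (all p) (sublists xs)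
sublists-filterᵇ p [] = refl
sublists-filterᵇ p (x ∷ xs) with p x in px
... | true = begin
  map (x ∷_) (sublists (filterᵇ p xs)) ++ sublists (filterᵇ p xs)
    ≡⟨ cong (λ S → map (x ∷_) S ++ S) (sublists-filterᵇ p xs) ⟩
  map (x ∷_) (filterᵇ (all p) (sublists xs)) ++ filterᵇ (all p) (sublists xs)
    ≡⟨ cong (λ S → map (x ∷_) S ++ filterᵇ (all p) (sublists xs))
            (filterᵇ-cong (all p) (λ M → all p (x ∷ M)) (sublists xs) (λ M → cong (_∧ all p M) (sym px))) ⟩
  map (x ∷_) (filterᵇ (λ M → all p (x ∷ M)) (sublists xs)) ++ filterᵇ (all p) (sublists xs)
    ≡⟨ cong (_++ filterᵇ (all p) (sublists xs)) (sym (filterᵇ-map-∷ (all p) x (sublists xs))) ⟩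
  filterᵇ (all p) (map (x ∷_) (sublists xs)) ++ filterᵇ (all p) (sublists xs)
    ≡⟨ sym (Listₚ.filter-++ (T? ∘ all p) (map (x ∷_) (sublists xs)) (sublists xs)) ⟩
  filterᵇ (all p) (map (x ∷_) (sublists xs) ++ sublists xs) ∎
  where open ≡-Reasoning
... | false = begin
  sublists (filterᵇ p xs)
    ≡⟨ sublists-filterᵇ p xs ⟩
  filterᵇ (all p) (sublists xs)
    ≡⟨ cong (_++ filterᵇ (all p) (sublists xs)) (sym (trans (filterᵇ-map-∷ (all p) x (sublists xs))
              (cong (map (x ∷_)) (filterᵇ-none _ (sublists xs) (λ {M} _ → cong (_∧ all p M) px))))) ⟩
  filterᵇ (all p) (map (x ∷_) (sublists xs)) ++ filterᵇ (all p) (sublists xs)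
    ≡⟨ sym (Listₚ.filter-++ (T? ∘ all p) (map (x ∷_) (sublists xs)) (sublists xs)) ⟩
  filterᵇ (all p) (map (x ∷_) (sublists xs) ++ sublists xs) ∎
  where open ≡-Reasoning

all-filterᵇ-irrelevant : ∀ (p q : A → Bool) xs → (∀ {y} → y ∈ₗ xs → q y ≡ true → p y ≡ true) →
  all p xs ≡ all p (filterᵇ (not ∘ q) xs)
all-filterᵇ-irrelevant p q [] h = refl
all-filterᵇ-irrelevant p q (x ∷ xs) h with q x in qx
... | true rewrite h (here refl) qx = all-filterᵇ-irrelevant p q xs (h ∘ there)
... | false = cong (p x ∧_) (all-filterᵇ-irrelevant p q xs (h ∘ there))

pairwiseᵇ-filterᵇ-irrelevant : ∀ (R : A → A → Bool) (q : A → Bool) L →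
  (∀ {x y} → x ∈ₗ L → y ∈ₗ L → q x ≡ true ⊎ q y ≡ true → R x y ≡ true) →
  pairwiseᵇ R L ≡ pairwiseᵇ R (filterᵇ (not ∘ q) L)
pairwiseᵇ-filterᵇ-irrelevant R q [] h = refl
pairwiseᵇ-filterᵇ-irrelevant R q (x ∷ L) h with q x in qx
... | true rewrite all⁺ (R x) L (λ y∈ → h (here refl) (there y∈) (inj₁ qx)) =
  pairwiseᵇ-filterᵇ-irrelevant R q L (λ x∈ y∈ → h (there x∈) (there y∈))
... | false = cong₂ _∧_ (all-filterᵇ-irrelevant (R x) q L (λ y∈ qy → h (here refl) (there y∈) (inj₂ qy)))
                        (pairwiseᵇ-filterᵇ-irrelevant R q L (λ x∈ y∈ → h (there x∈) (there y∈)))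

all-sublists-∷ : ∀ (g : List A → Bool) x L →
  all g (sublists (x ∷ L)) ≡ all (λ M → g (x ∷ M)) (sublists L) ∧ all g (sublists L)
all-sublists-∷ g x L =
  trans (all-++ g (map (x ∷_) (sublists L)) (sublists L)) (cong (_∧ all g (sublists L)) (all-map-∷ g x (sublists L)))

all-sublists-filterᵇ-irrelevant : ∀ (q : A → Bool) (g : List A → Bool) L →
  (∀ {M} → M ⊑ L → any q M ≡ true → g M ≡ true) →
  all g (sublists L) ≡ all g (sublists (filterᵇ (not ∘ q) L))
all-sublists-filterᵇ-irrelevant q g [] h = refl
all-sublists-filterᵇ-irrelevant q g (x ∷ L) h with q x in qx
... | true = begin
  all g (sublists (x ∷ L))
    ≡⟨ all-sublists-∷ g x L ⟩
  all (λ M → g (x ∷ M)) (sublists L) ∧ all g (sublists L)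
    ≡⟨ cong (_∧ all g (sublists L)) (all⁺ _ (sublists L) λ {M} M∈ →
         h (refl ∷ sublists⁻ L M∈) (cong (_∨ any q M) qx)) ⟩
  all g (sublists L)
    ≡⟨ all-sublists-filterᵇ-irrelevant q g L (λ s → h (x ∷ʳ s)) ⟩
  all g (sublists (filterᵇ (not ∘ q) L)) ∎
  where open ≡-Reasoning
... | false = begin
  all g (sublists (x ∷ L))
    ≡⟨ all-sublists-∷ g x L ⟩
  all (λ M → g (x ∷ M)) (sublists L) ∧ all g (sublists L)
    ≡⟨ cong₂ _∧_ (all-sublists-filterᵇ-irrelevant q (λ M → g (x ∷ M)) L
                    (λ {M} s qM → h (refl ∷ s) (trans (cong (_∨ any q M) qx) qM)))
                 (all-sublists-filterᵇ-irrelevant q g L (λ s → h (x ∷ʳ s))) ⟩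
  all (λ M → g (x ∷ M)) (sublists F) ∧ all g (sublists F)
    ≡⟨ sym (all-sublists-∷ g x F) ⟩
  all g (sublists (x ∷ F)) ∎
  where
  open ≡-Reasoning
  F = filterᵇ (not ∘ q) L

∑-sublists-∷ : ∀ x (xs : List A) (g : List A → ℤ) →
  ∑ (sublists (x ∷ xs)) g ≡ ∑ (sublists xs) (λ M → g (x ∷ M)) + ∑ (sublists xs) g
∑-sublists-∷ x xs g =
  trans (∑-++ (map (x ∷_) (sublists xs)) (sublists xs) g) (cong (_+ ∑ (sublists xs) g) (∑-map (sublists xs) (x ∷_) g))

∑-sublists-partition : ∀ (q : A → Bool) xs (G : List A → List A → ℤ) →
  ∑ (sublists xs) (λ L → G (filterᵇ q L) (filterᵇ (not ∘ q) L))
    ≡ ∑ (sublists (filterᵇ q xs)) (λ M → ∑ (sublists (filterᵇ (not ∘ q) xs)) (G M))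
∑-sublists-partition q [] G = sym (ℤₚ.+-identityʳ _)
∑-sublists-partition q (x ∷ xs) G with q x in qx
... | true = begin
  ∑ (sublists (x ∷ xs)) G′
    ≡⟨ ∑-sublists-∷ x xs G′ ⟩
  ∑ (sublists xs) (λ L → G′ (x ∷ L)) + ∑ (sublists xs) G′
    ≡⟨ cong₂ _+_ (trans (∑-cong (sublists xs) λ L →
                           cong₂ G (filterᵇ-accept q L qx) (filterᵇ-reject (not ∘ q) L (cong not qx)))
                        (∑-sublists-partition q xs (λ M → G (x ∷ M))))
                 (∑-sublists-partition q xs G) ⟩
  ∑ SM (λ M → ∑ SC (G (x ∷ M))) + ∑ SM (λ M → ∑ SC (G M))
    ≡⟨ sym (∑-sublists-∷ x (filterᵇ q xs) (λ M → ∑ SC (G M))) ⟩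
  ∑ (sublists (x ∷ filterᵇ q xs)) (λ M → ∑ SC (G M)) ∎
  where
  open ≡-Reasoning
  G′ = λ L → G (filterᵇ q L) (filterᵇ (not ∘ q) L)
  SM = sublists (filterᵇ q xs)
  SC = sublists (filterᵇ (not ∘ q) xs)
... | false = begin
  ∑ (sublists (x ∷ xs)) G′
    ≡⟨ ∑-sublists-∷ x xs G′ ⟩
  ∑ (sublists xs) (λ L → G′ (x ∷ L)) + ∑ (sublists xs) G′
    ≡⟨ cong₂ _+_ (trans (∑-cong (sublists xs) λ L →
                           cong₂ G (filterᵇ-reject q L qx) (filterᵇ-accept (not ∘ q) L (cong not qx)))
                        (∑-sublists-partition q xs (λ M C → G M (x ∷ C))))
                 (∑-sublists-partition q xs G) ⟩
  ∑ SM (λ M → ∑ SC (λ C → G M (x ∷ C))) + ∑ SM (λ M → ∑ SC (G M))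
    ≡⟨ sym (∑-+ SM _ _) ⟩
  ∑ SM (λ M → ∑ SC (λ C → G M (x ∷ C)) + ∑ SC (G M))
    ≡⟨ ∑-cong SM (λ M → sym (∑-sublists-∷ x (filterᵇ (not ∘ q) xs) (G M))) ⟩
  ∑ SM (λ M → ∑ (sublists (x ∷ filterᵇ (not ∘ q) xs)) (G M)) ∎
  where
  open ≡-Reasoning
  G′ = λ L → G (filterᵇ q L) (filterᵇ (not ∘ q) L)
  SM = sublists (filterᵇ q xs)
  SC = sublists (filterᵇ (not ∘ q) xs)

∑-sublists-power : ∀ (t : ℤ) (xs : List A) k →
  ∑ (sublists xs) (λ M → t ^ ((k ℕ.+ length xs) ∸ length M)) ≡ t ^ k * (t + 1ℤ) ^ length xs
∑-sublists-power t [] k = trans (ℤₚ.+-identityʳ _) (trans (cong (t ^_) (ℕₚ.+-identityʳ k)) (sym (ℤₚ.*-identityʳ _)))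
∑-sublists-power t (x ∷ xs) k = begin
  ∑ (sublists (x ∷ xs)) (λ M → t ^ ((k ℕ.+ suc (length xs)) ∸ length M))
    ≡⟨ ∑-sublists-∷ x xs _ ⟩
  ∑ (sublists xs) (λ M → t ^ ((k ℕ.+ suc (length xs)) ∸ suc (length M)))
    + ∑ (sublists xs) (λ M → t ^ ((k ℕ.+ suc (length xs)) ∸ length M))
    ≡⟨ cong₂ _+_ (trans (∑-cong (sublists xs) (λ M → cong (λ e → t ^ (e ∸ suc (length M))) k+1+ℓ≡))
                        (∑-sublists-power t xs k))
                 (trans (∑-cong (sublists xs) (λ M → cong (λ e → t ^ (e ∸ length M)) k+1+ℓ≡))
                        (∑-sublists-power t xs (suc k))) ⟩
  t ^ k * (t + 1ℤ) ^ length xs + t * t ^ k * (t + 1ℤ) ^ length xs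
    ≡⟨ factor t (t ^ k) _ ⟩
  t ^ k * ((t + 1ℤ) * (t + 1ℤ) ^ length xs) ∎
  where
  open ≡-Reasoning
  k+1+ℓ≡ : k ℕ.+ suc (length xs) ≡ suc (k ℕ.+ length xs)
  k+1+ℓ≡ = ℕₚ.+-suc k (length xs)
  factor : ∀ t x y → x * y + t * x * y ≡ x * ((t + 1ℤ) * y)
  factor = solve-∀

∑-sublists-complete : ∀ {xs : List A} → Unique xs → (g : List A → ℤ) →
  (∀ {M x} → M ⊑ xs → x ∈ₗ xs → x ∉ₗ M → g M ≡ 0ℤ) → ∑ (sublists xs) g ≡ g xs
∑-sublists-complete {xs = []} _ g _ = ℤₚ.+-identityʳ (g [])
∑-sublists-complete {xs = x ∷ xs} (x∉ ∷ xs-unique) g vanish = begin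
  ∑ (sublists (x ∷ xs)) g
    ≡⟨ ∑-sublists-∷ x xs g ⟩
  ∑ (sublists xs) (λ M → g (x ∷ M)) + ∑ (sublists xs) g
    ≡⟨ cong₂ _+_ (∑-sublists-complete xs-unique (λ M → g (x ∷ M)) vanish-with-x)
                 (∑-vanishes (sublists xs) λ M∈ →
                   vanish (x ∷ʳ sublists⁻ xs M∈) (here refl) (x∉xs ∘ ∈-resp-⊑ (sublists⁻ xs M∈))) ⟩
  g (x ∷ xs) + 0ℤ
    ≡⟨ ℤₚ.+-identityʳ _ ⟩
  g (x ∷ xs) ∎
  where
  open ≡-Reasoning
  x∉xs : x ∉ₗ xs
  x∉xs = All¬⇒¬Any x∉
  vanish-with-x : ∀ {M y} → M ⊑ xs → y ∈ₗ xs → y ∉ₗ M → g (x ∷ M) ≡ 0ℤ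
  vanish-with-x s y∈ y∉M = vanish (refl ∷ s) (there y∈) λ where
    (here refl) → x∉xs y∈
    (there y∈M) → y∉M y∈M

-- Subsets of Fin n

_≟ˢ_ : DecidableEquality (Subset n)
_≟ˢ_ = Vecₚ.≡-dec Boolₚ._≟_

⊆ᵇ⇒⊆ : ∀ {p q : Subset n} → (p ⊆ᵇ q) ≡ true → p ⊆ q
⊆ᵇ⇒⊆ {p = true ∷ p} {q = true ∷ q} h here = here
⊆ᵇ⇒⊆ {p = true ∷ p} {q = true ∷ q} h (there x∈p) = there (⊆ᵇ⇒⊆ h x∈p)
⊆ᵇ⇒⊆ {p = false ∷ p} {q = _ ∷ q} h (there x∈p) = there (⊆ᵇ⇒⊆ h x∈p)

⊆⇒⊆ᵇ : ∀ {p q : Subset n} → p ⊆ q → (p ⊆ᵇ q) ≡ true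
⊆⇒⊆ᵇ {p = []} {q = []} h = refl
⊆⇒⊆ᵇ {p = true ∷ p} {q = true ∷ q} h = ⊆⇒⊆ᵇ (Subsetₚ.drop-∷-⊆ h)
⊆⇒⊆ᵇ {p = true ∷ p} {q = false ∷ q} h with () ← h here
⊆⇒⊆ᵇ {p = false ∷ p} {q = true ∷ q} h = ⊆⇒⊆ᵇ (Subsetₚ.drop-∷-⊆ h)
⊆⇒⊆ᵇ {p = false ∷ p} {q = false ∷ q} h = ⊆⇒⊆ᵇ (Subsetₚ.drop-∷-⊆ h)

⊆ᵇ-refl : ∀ (p : Subset n) → (p ⊆ᵇ p) ≡ true
⊆ᵇ-refl p = ⊆⇒⊆ᵇ {p = p} {p} id

⊆ᵇ⇒∣p∣≤∣q∣ : ∀ (p q : Subset n) → (p ⊆ᵇ q) ≡ true → ∣ p ∣ ≤ ∣ q ∣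
⊆ᵇ⇒∣p∣≤∣q∣ p q h = Subsetₚ.p⊆q⇒∣p∣≤∣q∣ {p = p} {q} (⊆ᵇ⇒⊆ h)

⊆∧∣q∣≤∣p∣⇒≡ : ∀ {p q : Subset n} → p ⊆ q → ∣ q ∣ ≤ ∣ p ∣ → p ≡ q
⊆∧∣q∣≤∣p∣⇒≡ {p = []} {q = []} _ _ = refl
⊆∧∣q∣≤∣p∣⇒≡ {p = true ∷ p} {q = true ∷ q} h c = cong (true ∷_) (⊆∧∣q∣≤∣p∣⇒≡ (Subsetₚ.drop-∷-⊆ h) (ℕₚ.≤-pred c))
⊆∧∣q∣≤∣p∣⇒≡ {p = true ∷ p} {q = false ∷ q} h c with () ← h here
⊆∧∣q∣≤∣p∣⇒≡ {p = false ∷ p} {q = true ∷ q} h c =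
  ⊥₀-elim (ℕₚ.<-irrefl refl (ℕₚ.≤-trans (s≤s (Subsetₚ.p⊆q⇒∣p∣≤∣q∣ (Subsetₚ.drop-∷-⊆ h))) c))
⊆∧∣q∣≤∣p∣⇒≡ {p = false ∷ p} {q = false ∷ q} h c = cong (false ∷_) (⊆∧∣q∣≤∣p∣⇒≡ (Subsetₚ.drop-∷-⊆ h) c)

⊈ᵇ⇒∣q∣<∣p∪q∣ : ∀ (p q : Subset n) → (p ⊆ᵇ q) ≡ false → ∣ q ∣ < ∣ p ∪ q ∣
⊈ᵇ⇒∣q∣<∣p∪q∣ [] [] ()
⊈ᵇ⇒∣q∣<∣p∪q∣ (true ∷ p) (true ∷ q) h = s≤s (⊈ᵇ⇒∣q∣<∣p∪q∣ p q h)
⊈ᵇ⇒∣q∣<∣p∪q∣ (true ∷ p) (false ∷ q) h = s≤s (Subsetₚ.∣q∣≤∣p∪q∣ p q)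
⊈ᵇ⇒∣q∣<∣p∪q∣ (false ∷ p) (true ∷ q) h = s≤s (⊈ᵇ⇒∣q∣<∣p∪q∣ p q h)
⊈ᵇ⇒∣q∣<∣p∪q∣ (false ∷ p) (false ∷ q) h = ⊈ᵇ⇒∣q∣<∣p∪q∣ p q h

∪-⊆ᵇ : ∀ (p q s : Subset n) → ((p ∪ q) ⊆ᵇ s) ≡ (p ⊆ᵇ s) ∧ (q ⊆ᵇ s)
∪-⊆ᵇ [] [] [] = refl
∪-⊆ᵇ (true ∷ p) (true ∷ q) (true ∷ s) = ∪-⊆ᵇ p q s
∪-⊆ᵇ (true ∷ p) (false ∷ q) (true ∷ s) = ∪-⊆ᵇ p q s
∪-⊆ᵇ (true ∷ p) (_ ∷ q) (false ∷ s) = refl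
∪-⊆ᵇ (false ∷ p) (true ∷ q) (true ∷ s) = ∪-⊆ᵇ p q s
∪-⊆ᵇ (false ∷ p) (true ∷ q) (false ∷ s) = sym (∧-comm (p ⊆ᵇ s) false)
∪-⊆ᵇ (false ∷ p) (false ∷ q) (_ ∷ s) = ∪-⊆ᵇ p q s

⊥-⊆ᵇ : ∀ (s : Subset n) → (⊥ ⊆ᵇ s) ≡ true
⊥-⊆ᵇ [] = refl
⊥-⊆ᵇ (true ∷ s) = ⊥-⊆ᵇ s
⊥-⊆ᵇ (false ∷ s) = ⊥-⊆ᵇ s

isEmptyᵇ⇒∉ : ∀ {p : Subset n} {x} → isEmptyᵇ p ≡ true → x ∉ p
isEmptyᵇ⇒∉ {p = true ∷ p} () here
isEmptyᵇ⇒∉ {p = true ∷ p} () (there _)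
isEmptyᵇ⇒∉ {p = false ∷ p} h (there x∈p) = isEmptyᵇ⇒∉ h x∈p

¬isEmptyᵇ⇒Nonempty : ∀ {p : Subset n} → isEmptyᵇ p ≡ false → Nonempty p
¬isEmptyᵇ⇒Nonempty {p = true ∷ p} h = zero , here
¬isEmptyᵇ⇒Nonempty {p = false ∷ p} h with x , x∈p ← ¬isEmptyᵇ⇒Nonempty {p = p} h = suc x , there x∈p

disjointᵇ-comm : ∀ (p q : Subset n) → disjointᵇ p q ≡ disjointᵇ q p
disjointᵇ-comm p q = cong isEmptyᵇ (Subsetₚ.∩-comm p q)

disjointᵇ⇒∉ : ∀ {p q : Subset n} {x} → disjointᵇ p q ≡ true → x ∈ p → x ∉ q
disjointᵇ⇒∉ h x∈p x∈q = isEmptyᵇ⇒∉ h (Subsetₚ.x∈p∩q⁺ (x∈p , x∈q))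

¬disjointᵇ⇒Nonempty : ∀ {p q : Subset n} → disjointᵇ p q ≡ false → Nonempty (p ∩ q)
¬disjointᵇ⇒Nonempty = ¬isEmptyᵇ⇒Nonempty

common⇒¬disjointᵇ : ∀ {p q : Subset n} {x} → x ∈ p → x ∈ q → disjointᵇ p q ≡ false
common⇒¬disjointᵇ {p = p} {q} x∈p x∈q with disjointᵇ p q in eq
... | true = ⊥₀-elim (disjointᵇ⇒∉ eq x∈p x∈q)
... | false = refl

disjointᵇ-∪ : ∀ (r p q : Subset n) → disjointᵇ r (p ∪ q) ≡ disjointᵇ r p ∧ disjointᵇ r q
disjointᵇ-∪ [] [] [] = refl
disjointᵇ-∪ (true ∷ r) (true ∷ p) (_ ∷ q) = refl
disjointᵇ-∪ (true ∷ r) (false ∷ p) (true ∷ q) = sym (∧-comm (disjointᵇ r p) false)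
disjointᵇ-∪ (true ∷ r) (false ∷ p) (false ∷ q) = disjointᵇ-∪ r p q
disjointᵇ-∪ (false ∷ r) (_ ∷ p) (_ ∷ q) = disjointᵇ-∪ r p q

disjointᵇ-⊥ : ∀ (r : Subset n) → disjointᵇ r ⊥ ≡ true
disjointᵇ-⊥ [] = refl
disjointᵇ-⊥ (true ∷ r) = disjointᵇ-⊥ r
disjointᵇ-⊥ (false ∷ r) = disjointᵇ-⊥ r

∣∪∣-disjoint : ∀ (p q : Subset n) → disjointᵇ p q ≡ true → ∣ p ∪ q ∣ ≡ ∣ p ∣ ℕ.+ ∣ q ∣
∣∪∣-disjoint [] [] h = refl
∣∪∣-disjoint (true ∷ p) (false ∷ q) h = cong suc (∣∪∣-disjoint p q h)
∣∪∣-disjoint (false ∷ p) (true ∷ q) h = trans (cong suc (∣∪∣-disjoint p q h)) (sym (ℕₚ.+-suc ∣ p ∣ ∣ q ∣))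
∣∪∣-disjoint (false ∷ p) (false ∷ q) h = ∣∪∣-disjoint p q h

∈⋃⁻ : ∀ {x : Fin n} (L : List (Subset n)) → x ∈ ⋃ L → ∃ λ J → J ∈ₗ L × x ∈ J
∈⋃⁻ [] x∈ = ⊥₀-elim (Subsetₚ.∉⊥ x∈)
∈⋃⁻ (J ∷ L) x∈ with Subsetₚ.x∈p∪q⁻ J (⋃ L) x∈
... | inj₁ x∈J = J , here refl , x∈J
... | inj₂ x∈⋃L with K , K∈L , x∈K ← ∈⋃⁻ L x∈⋃L = K , there K∈L , x∈K

∈⋃⁺ : ∀ {x : Fin n} {J} (L : List (Subset n)) → J ∈ₗ L → x ∈ J → x ∈ ⋃ L
∈⋃⁺ (J ∷ L) (here refl) x∈J = Subsetₚ.x∈p∪q⁺ (inj₁ x∈J)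
∈⋃⁺ (K ∷ L) (there J∈L) x∈J = Subsetₚ.x∈p∪q⁺ (inj₂ (∈⋃⁺ L J∈L x∈J))

NestedOrDisjoint : Subset n → Subset n → Set
NestedOrDisjoint I J = I ⊆ J ⊎ J ⊆ I ⊎ disjointᵇ I J ≡ true

nestedOrDisjointᵇ⇒ : ∀ {I J : Subset n} → nestedOrDisjointᵇ I J ≡ true → NestedOrDisjoint I J
nestedOrDisjointᵇ⇒ {I = I} {J} h with I ⊆ᵇ J in I⊆J | J ⊆ᵇ I in J⊆I | disjointᵇ I J in I∩J≡∅
... | true | _ | _ = inj₁ (⊆ᵇ⇒⊆ I⊆J)
... | false | true | _ = inj₂ (inj₁ (⊆ᵇ⇒⊆ J⊆I))
... | false | false | true = inj₂ (inj₂ refl)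

⇒nestedOrDisjointᵇ : ∀ {I J : Subset n} → NestedOrDisjoint I J → nestedOrDisjointᵇ I J ≡ true
⇒nestedOrDisjointᵇ {I = I} {J} (inj₁ I⊆J) rewrite ⊆⇒⊆ᵇ I⊆J = refl
⇒nestedOrDisjointᵇ {I = I} {J} (inj₂ (inj₁ J⊆I)) rewrite ⊆⇒⊆ᵇ J⊆I with I ⊆ᵇ J
... | true = refl
... | false = refl
⇒nestedOrDisjointᵇ {I = I} {J} (inj₂ (inj₂ I∩J≡∅)) rewrite I∩J≡∅ with I ⊆ᵇ J | J ⊆ᵇ I
... | true | _ = refl
... | false | true = refl
... | false | false = refl

_⊂ᵇ_ : Subset n → Subset n → Bool
I ⊂ᵇ J = (I ⊆ᵇ J) ∧ not (J ⊆ᵇ I)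

maximals : List (Subset n) → List (Subset n)
maximals T = filterᵇ (λ J → not (any (J ⊂ᵇ_) T)) T

maximals-⊑ : ∀ (T : List (Subset n)) → maximals T ⊑ T
maximals-⊑ T = filter-⊆ _ T

⊆-maximals : ∀ {T : List (Subset n)} {J} → J ∈ₗ T → ∃ λ K → K ∈ₗ maximals T × J ⊆ K
⊆-maximals {T = T} {J} J∈T = K , ∈-filterᵇ⁺ _ K∈T (cong not (any-false⁺ (K ⊂ᵇ_) T K-maximal)) , J⊆K
  where
  above-J = filterᵇ (J ⊆ᵇ_) T
  largest = argmax ∣_∣ above-J (∈-filterᵇ⁺ (J ⊆ᵇ_) J∈T (⊆ᵇ-refl J))
  K = proj₁ largest
  K∈T = proj₁ (∈-filterᵇ⁻ (J ⊆ᵇ_) T (proj₁ (proj₂ largest)))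
  J⊆K = ⊆ᵇ⇒⊆ (proj₂ (∈-filterᵇ⁻ (J ⊆ᵇ_) T (proj₁ (proj₂ largest))))
  K-maximal : ∀ {K′} → K′ ∈ₗ T → (K ⊂ᵇ K′) ≡ false
  K-maximal {K′} K′∈T with K ⊆ᵇ K′ in K⊆K′
  ... | false = refl
  ... | true = cong not (trans (cong (_⊆ᵇ K) (sym K≡K′)) (⊆ᵇ-refl K))
    where
    K≡K′ : K ≡ K′
    K≡K′ = ⊆∧∣q∣≤∣p∣⇒≡ (⊆ᵇ⇒⊆ K⊆K′)
             (proj₂ (proj₂ largest) (∈-filterᵇ⁺ (J ⊆ᵇ_) K′∈T (⊆⇒⊆ᵇ (Subsetₚ.⊆-trans J⊆K (⊆ᵇ⇒⊆ K⊆K′)))))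

maximals-pairwise-disjoint : ∀ {T : List (Subset n)} → Unique T → (∀ {I J} → I ∈ₗ T → J ∈ₗ T → NestedOrDisjoint I J) →
  pairwiseᵇ disjointᵇ (maximals T) ≡ true
maximals-pairwise-disjoint {T = T} T-unique nested =
  pairwiseᵇ⁺ disjointᵇ (maximals T) (Unique-resp-⊑ (maximals-⊑ T) T-unique) disjoint
  where
  not-strictly-below : ∀ {I J} → I ∈ₗ maximals T → J ∈ₗ T → I ⊆ J → I ≢ J → ⊥₀
  not-strictly-below {I} {J} I∈ J∈T I⊆J I≢J with J ⊆ᵇ I in J⊆I
  ... | true = I≢J (Subsetₚ.⊆-antisym I⊆J (⊆ᵇ⇒⊆ J⊆I))
  ... | false = true≢false (trans (sym (proj₂ (∈-filterᵇ⁻ _ T I∈)))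
                                  (cong not (any-true⁺ (I ⊂ᵇ_) T J∈T (cong₂ _∧_ (⊆⇒⊆ᵇ I⊆J) (cong not J⊆I)))))
  disjoint : ∀ {I J} → I ∈ₗ maximals T → J ∈ₗ maximals T → I ≢ J → disjointᵇ I J ≡ true
  disjoint I∈ J∈ I≢J with nested (∈-resp-⊑ (maximals-⊑ T) I∈) (∈-resp-⊑ (maximals-⊑ T) J∈)
  ... | inj₁ I⊆J = ⊥₀-elim (not-strictly-below I∈ (∈-resp-⊑ (maximals-⊑ T) J∈) I⊆J I≢J)
  ... | inj₂ (inj₁ J⊆I) = ⊥₀-elim (not-strictly-below J∈ (∈-resp-⊑ (maximals-⊑ T) I∈) J⊆I (I≢J ∘ sym))
  ... | inj₂ (inj₂ I∩J≡∅) = I∩J≡∅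

all-⊆ᵇ-⋃ : ∀ (L : List (Subset n)) S → all (_⊆ᵇ S) L ≡ (⋃ L ⊆ᵇ S)
all-⊆ᵇ-⋃ [] S = sym (⊥-⊆ᵇ S)
all-⊆ᵇ-⋃ (J ∷ L) S = trans (cong ((J ⊆ᵇ S) ∧_) (all-⊆ᵇ-⋃ L S)) (sym (∪-⊆ᵇ J (⋃ L) S))

all-disjointᵇ-⋃ : ∀ (L : List (Subset n)) R → all (disjointᵇ R) L ≡ disjointᵇ R (⋃ L)
all-disjointᵇ-⋃ [] R = sym (disjointᵇ-⊥ R)
all-disjointᵇ-⋃ (J ∷ L) R = trans (cong (disjointᵇ R J ∧_) (all-disjointᵇ-⋃ L R)) (sym (disjointᵇ-∪ R J (⋃ L)))

⋃-partitionᵇ : ∀ (q : Subset n → Bool) L → ⋃ L ≡ ⋃ (filterᵇ q L) ∪ ⋃ (filterᵇ (not ∘ q) L)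
⋃-partitionᵇ q [] = sym (Subsetₚ.∪-idem ⊥)
⋃-partitionᵇ q (J ∷ L) with q J
... | true = trans (cong (J ∪_) (⋃-partitionᵇ q L)) (sym (Subsetₚ.∪-assoc J _ _))
... | false = trans (cong (J ∪_) (⋃-partitionᵇ q L))
                   (trans (sym (Subsetₚ.∪-assoc J _ _)) (trans (cong (_∪ _) (Subsetₚ.∪-comm J _)) (Subsetₚ.∪-assoc _ J _)))

∈-allSubsets : ∀ (p : Subset n) → p ∈ₗ allSubsets n
∈-allSubsets [] = here refl
∈-allSubsets {suc n} (true ∷ p) = ∈-++⁺ˡ (∈-map⁺ (true ∷_) (∈-allSubsets p))
∈-allSubsets {suc n} (false ∷ p) = ∈-++⁺ʳ (map (true ∷_) (allSubsets n)) (∈-map⁺ (false ∷_) (∈-allSubsets p))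

allSubsets-Unique : ∀ n → Unique (allSubsets n)
allSubsets-Unique zero = [] ∷ []
allSubsets-Unique (suc n) =
  Uniqueₚ.++⁺ (Uniqueₚ.map⁺ ∷-injectiveʳ (allSubsets-Unique n))
              (Uniqueₚ.map⁺ ∷-injectiveʳ (allSubsets-Unique n)) heads-differ
  where
  ∷-injectiveʳ : ∀ {b} {x y : Subset n} → (b ∷ x) ≡ (b ∷ y) → x ≡ y
  ∷-injectiveʳ refl = refl
  heads-differ : ∀ {v} → ¬ (v ∈ₗ map (true ∷_) (allSubsets n) × v ∈ₗ map (false ∷_) (allSubsets n))
  heads-differ (v∈₁ , v∈₂) with ∈-map⁻ (true ∷_) v∈₁ | ∈-map⁻ (false ∷_) v∈₂
  ... | _ , _ , refl | _ , _ , ()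

∑-allSubsets-suc : ∀ n (f : Subset (suc n) → ℤ) →
  ∑ (allSubsets (suc n)) f ≡ ∑ (allSubsets n) (λ S → f (true ∷ S)) + ∑ (allSubsets n) (λ S → f (false ∷ S))
∑-allSubsets-suc n f = trans (∑-++ (map (true ∷_) (allSubsets n)) _ f)
                             (cong₂ _+_ (∑-map (allSubsets n) (true ∷_) f) (∑-map (allSubsets n) (false ∷_) f))

∑-supersets-binomial : ∀ n (U : Subset n) (a b : ℤ) →
  ∑ (allSubsets n) (λ S → ind (U ⊆ᵇ S) (a ^ (n ∸ ∣ S ∣) * b ^ (∣ S ∣ ∸ ∣ U ∣))) ≡ (a + b) ^ (n ∸ ∣ U ∣)
∑-supersets-binomial zero [] a b = refl
∑-supersets-binomial (suc n) (true ∷ U) a b = begin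
  _ ≡⟨ ∑-allSubsets-suc n _ ⟩
  ∑ (allSubsets n) term + ∑ (allSubsets n) (λ _ → 0ℤ)
    ≡⟨ cong₂ _+_ (∑-supersets-binomial n U a b) (∑-zero (allSubsets n)) ⟩
  (a + b) ^ (n ∸ ∣ U ∣) + 0ℤ
    ≡⟨ ℤₚ.+-identityʳ _ ⟩
  (a + b) ^ (n ∸ ∣ U ∣) ∎
  where
  open ≡-Reasoning
  term = λ S → ind (U ⊆ᵇ S) (a ^ (n ∸ ∣ S ∣) * b ^ (∣ S ∣ ∸ ∣ U ∣))
∑-supersets-binomial (suc n) (false ∷ U) a b = begin
  _ ≡⟨ ∑-allSubsets-suc n _ ⟩
  ∑ (allSubsets n) (λ S → ind (U ⊆ᵇ S) (a ^ (n ∸ ∣ S ∣) * b ^ (suc ∣ S ∣ ∸ ∣ U ∣)))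
    + ∑ (allSubsets n) (λ S → ind (U ⊆ᵇ S) (a ^ (suc n ∸ ∣ S ∣) * b ^ (∣ S ∣ ∸ ∣ U ∣)))
    ≡⟨ cong₂ _+_ (trans (∑-cong (allSubsets n) with-S) (∑-*ˡ (allSubsets n) b term))
                 (trans (∑-cong (allSubsets n) without-S) (∑-*ˡ (allSubsets n) a term)) ⟩
  b * ∑ (allSubsets n) term + a * ∑ (allSubsets n) term
    ≡⟨ cong (λ z → b * z + a * z) (∑-supersets-binomial n U a b) ⟩
  b * (a + b) ^ (n ∸ ∣ U ∣) + a * (a + b) ^ (n ∸ ∣ U ∣)
    ≡⟨ factor a b ((a + b) ^ (n ∸ ∣ U ∣)) ⟩
  (a + b) ^ suc (n ∸ ∣ U ∣)
    ≡⟨ cong ((a + b) ^_) (sym (1+m∸k≡1+[m∸k] (Subsetₚ.∣p∣≤n U))) ⟩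
  (a + b) ^ (suc n ∸ ∣ U ∣) ∎
  where
  open ≡-Reasoning
  term = λ S → ind (U ⊆ᵇ S) (a ^ (n ∸ ∣ S ∣) * b ^ (∣ S ∣ ∸ ∣ U ∣))
  factor : ∀ a b z → b * z + a * z ≡ (a + b) * z
  factor = solve-∀
  with-S : ∀ S → ind (U ⊆ᵇ S) (a ^ (n ∸ ∣ S ∣) * b ^ (suc ∣ S ∣ ∸ ∣ U ∣)) ≡ b * term S
  with-S S with U ⊆ᵇ S in U⊆S
  ... | false = sym (ℤₚ.*-zeroʳ b)
  ... | true = trans (cong (λ e → a ^ (n ∸ ∣ S ∣) * b ^ e) (1+m∸k≡1+[m∸k] (⊆ᵇ⇒∣p∣≤∣q∣ U S U⊆S)))
                     (swap (a ^ (n ∸ ∣ S ∣)) b (b ^ (∣ S ∣ ∸ ∣ U ∣)))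
    where
    swap : ∀ x b y → x * (b * y) ≡ b * (x * y)
    swap = solve-∀
  without-S : ∀ S → ind (U ⊆ᵇ S) (a ^ (suc n ∸ ∣ S ∣) * b ^ (∣ S ∣ ∸ ∣ U ∣)) ≡ a * term S
  without-S S = trans (cong (λ e → ind (U ⊆ᵇ S) (a ^ e * b ^ (∣ S ∣ ∸ ∣ U ∣))) (1+m∸k≡1+[m∸k] (Subsetₚ.∣p∣≤n S)))
                      (trans (cong (ind (U ⊆ᵇ S)) (ℤₚ.*-assoc a _ _)) (ind-*ˡ (U ⊆ᵇ S) a _))

∑-disjoint-subsets : ∀ n (S U : Subset n) (t : ℤ) → (U ⊆ᵇ S) ≡ true → ∀ k →
  ∑ (allSubsets n) (λ R → ind ((R ⊆ᵇ S) ∧ disjointᵇ R U) (t ^ ((k ℕ.+ (∣ S ∣ ∸ ∣ U ∣)) ∸ ∣ R ∣)))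
    ≡ t ^ k * (t + 1ℤ) ^ (∣ S ∣ ∸ ∣ U ∣)
∑-disjoint-subsets zero [] [] t _ k = trans (ℤₚ.+-identityʳ _) (trans (cong (t ^_) (ℕₚ.+-identityʳ k)) (sym (ℤₚ.*-identityʳ _)))
∑-disjoint-subsets (suc n) (true ∷ S) (true ∷ U) t U⊆S k = begin
  _ ≡⟨ ∑-allSubsets-suc n _ ⟩
  ∑ (allSubsets n) (λ R → ind ((R ⊆ᵇ S) ∧ false) _) + ∑ (allSubsets n) term
    ≡⟨ cong₂ _+_ (∑-vanishes (allSubsets n) (λ {R} _ → ind-∧-false (R ⊆ᵇ S))) (∑-disjoint-subsets n S U t U⊆S k) ⟩
  0ℤ + t ^ k * (t + 1ℤ) ^ (∣ S ∣ ∸ ∣ U ∣) ≡⟨ ℤₚ.+-identityˡ _ ⟩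
  _ ∎
  where
  open ≡-Reasoning
  term = λ R → ind ((R ⊆ᵇ S) ∧ disjointᵇ R U) (t ^ ((k ℕ.+ (∣ S ∣ ∸ ∣ U ∣)) ∸ ∣ R ∣))
  ind-∧-false : ∀ b {z} → ind (b ∧ false) z ≡ 0ℤ
  ind-∧-false true = refl
  ind-∧-false false = refl
∑-disjoint-subsets (suc n) (true ∷ S) (false ∷ U) t U⊆S k = begin
  _ ≡⟨ ∑-allSubsets-suc n _ ⟩
  ∑ (allSubsets n) (λ R → ind (P R) (t ^ ((k ℕ.+ (suc ∣ S ∣ ∸ ∣ U ∣)) ∸ suc ∣ R ∣)))
    + ∑ (allSubsets n) (λ R → ind (P R) (t ^ ((k ℕ.+ (suc ∣ S ∣ ∸ ∣ U ∣)) ∸ ∣ R ∣)))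
    ≡⟨ cong₂ _+_ (trans (∑-cong (allSubsets n) (λ R → cong (λ e → ind (P R) (t ^ (e ∸ suc ∣ R ∣))) k+∣S∣∸∣U∣))
                        (∑-disjoint-subsets n S U t U⊆S k))
                 (trans (∑-cong (allSubsets n) (λ R → cong (λ e → ind (P R) (t ^ (e ∸ ∣ R ∣))) k+∣S∣∸∣U∣))
                        (∑-disjoint-subsets n S U t U⊆S (suc k))) ⟩
  t ^ k * (t + 1ℤ) ^ (∣ S ∣ ∸ ∣ U ∣) + t * t ^ k * (t + 1ℤ) ^ (∣ S ∣ ∸ ∣ U ∣)
    ≡⟨ factor t (t ^ k) ((t + 1ℤ) ^ (∣ S ∣ ∸ ∣ U ∣)) ⟩
  t ^ k * ((t + 1ℤ) * (t + 1ℤ) ^ (∣ S ∣ ∸ ∣ U ∣))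
    ≡⟨ cong (λ e → t ^ k * (t + 1ℤ) ^ e) (sym (1+m∸k≡1+[m∸k] ∣U∣≤∣S∣)) ⟩
  t ^ k * (t + 1ℤ) ^ (suc ∣ S ∣ ∸ ∣ U ∣) ∎
  where
  open ≡-Reasoning
  P = λ R → (R ⊆ᵇ S) ∧ disjointᵇ R U
  ∣U∣≤∣S∣ : ∣ U ∣ ≤ ∣ S ∣
  ∣U∣≤∣S∣ = ⊆ᵇ⇒∣p∣≤∣q∣ U S U⊆S
  k+∣S∣∸∣U∣ : k ℕ.+ (suc ∣ S ∣ ∸ ∣ U ∣) ≡ suc (k ℕ.+ (∣ S ∣ ∸ ∣ U ∣))
  k+∣S∣∸∣U∣ = trans (cong (k ℕ.+_) (1+m∸k≡1+[m∸k] ∣U∣≤∣S∣)) (ℕₚ.+-suc k _)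
  factor : ∀ t x y → x * y + t * x * y ≡ x * ((t + 1ℤ) * y)
  factor = solve-∀
∑-disjoint-subsets (suc n) (false ∷ S) (false ∷ U) t U⊆S k = begin
  _ ≡⟨ ∑-allSubsets-suc n _ ⟩
  ∑ (allSubsets n) (λ _ → 0ℤ)
    + ∑ (allSubsets n) (λ R → ind ((R ⊆ᵇ S) ∧ disjointᵇ R U) (t ^ ((k ℕ.+ (∣ S ∣ ∸ ∣ U ∣)) ∸ ∣ R ∣)))
    ≡⟨ cong₂ _+_ (∑-zero (allSubsets n)) (∑-disjoint-subsets n S U t U⊆S k) ⟩
  0ℤ + t ^ k * (t + 1ℤ) ^ (∣ S ∣ ∸ ∣ U ∣) ≡⟨ ℤₚ.+-identityˡ _ ⟩
  _ ∎
  where open ≡-Reasoning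

nestedCond-restrict : ∀ (B : Subset n → Bool) S L → all (_⊆ᵇ S) L ≡ true →
  nestedCondᵇ (restrict B S) L ≡ nestedCondᵇ B L
nestedCond-restrict B S L L⊆S = cong (pairwiseᵇ nestedOrDisjointᵇ L ∧_) (all-cong-∈ _ _ (sublists L) same-test)
  where
  same-test : ∀ {M} → M ∈ₗ sublists L →
    not ((2 ≤ᵇ length M) ∧ pairwiseᵇ disjointᵇ M ∧ (B (⋃ M) ∧ (⋃ M ⊆ᵇ S)))
      ≡ not ((2 ≤ᵇ length M) ∧ pairwiseᵇ disjointᵇ M ∧ B (⋃ M))
  same-test {M} M∈ = cong (λ b → not ((2 ≤ᵇ length M) ∧ pairwiseᵇ disjointᵇ M ∧ b))
    (trans (cong (B (⋃ M) ∧_) ⋃M⊆S) (Boolₚ.∧-identityʳ _))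
    where
    ⋃M⊆S : (⋃ M ⊆ᵇ S) ≡ true
    ⋃M⊆S = trans (sym (all-⊆ᵇ-⋃ M S)) (all⁺ _ M (all⁻ _ L L⊆S ∘ ∈-resp-⊑ (sublists⁻ L M∈)))

-- Building sets and nested collections

module BuildingSetProperties {n : ℕ} (B : Subset n → Bool) (isBuildingSet : IsBuildingSet B) where

  open IsBuildingSet isBuildingSet

  InB : Subset n → Set
  InB J = B J ≡ true

  members-Unique : Unique (members B)
  members-Unique = Uniqueₚ.filter⁺ (T? ∘ B) (allSubsets-Unique n)

  ∈members⁻ : ∀ {J} → J ∈ₗ members B → InB J
  ∈members⁻ J∈ = proj₂ (∈-filterᵇ⁻ B (allSubsets n) J∈)

  ∈members⁺ : ∀ {J} → InB J → J ∈ₗ members B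
  ∈members⁺ {J} J∈B = ∈-filterᵇ⁺ B (∈-allSubsets J) J∈B

  isMax : Subset n → Bool
  isMax = isMaxᵇ B

  isMax⇒InB : ∀ {m} → isMax m ≡ true → InB m
  isMax⇒InB h = proj₁ (∧-true⁻ h)

  isMax-⊆⇒≡ : ∀ {m J} → isMax m ≡ true → InB J → m ⊆ J → J ≡ m
  isMax-⊆⇒≡ {m} {J} m-max J∈B m⊆J = Subsetₚ.⊆-antisym (⊆ᵇ⇒⊆ J⊆ᵇm) m⊆J
    where
    no-strict-superset = any-false⁻ _ (allSubsets n) (not-true⁻ (proj₂ (∧-true⁻ m-max))) (∈-allSubsets J)
    J⊆ᵇm : (J ⊆ᵇ m) ≡ true
    J⊆ᵇm = not-false⁻ (trans (sym (cong₂ (λ b c → b ∧ c ∧ not (J ⊆ᵇ m)) J∈B (⊆⇒⊆ᵇ m⊆J))) no-strict-superset)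

  isMax-absorbs : ∀ {m J} → isMax m ≡ true → InB J → disjointᵇ m J ≡ false → J ⊆ m
  isMax-absorbs {m} {J} m-max J∈B m∩J≢∅ = λ x∈J → subst (_ ∈_) m∪J≡m (Subsetₚ.q⊆p∪q m J x∈J)
    where
    m∪J≡m : m ∪ J ≡ m
    m∪J≡m = isMax-⊆⇒≡ m-max (union-closed m J (isMax⇒InB m-max) J∈B (¬disjointᵇ⇒Nonempty m∩J≢∅)) (Subsetₚ.p⊆p∪q J)

  ⊆-isMax : ∀ {J} → InB J → ∃ λ m → isMax m ≡ true × J ⊆ m
  ⊆-isMax {J} J∈B = m , m-max , J⊆m
    where
    above-J : Subset n → Bool
    above-J K = B K ∧ (J ⊆ᵇ K)
    candidates = filterᵇ above-J (allSubsets n)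
    J∈candidates : J ∈ₗ candidates
    J∈candidates = ∈-filterᵇ⁺ above-J (∈-allSubsets J) (subst (λ b → b ∧ (J ⊆ᵇ J) ≡ true) (sym J∈B) (⊆ᵇ-refl J))
    largest = argmax ∣_∣ candidates J∈candidates
    m = proj₁ largest
    m-above-J = ∧-true⁻ (proj₂ (∈-filterᵇ⁻ above-J (allSubsets n) (proj₁ (proj₂ largest))))
    J⊆m = ⊆ᵇ⇒⊆ (proj₂ m-above-J)
    m-max : isMax m ≡ true
    m-max = cong₂ _∧_ (proj₁ m-above-J) (cong not (any-false⁺ _ (allSubsets n) no-strict-superset))
      where
      no-strict-superset : ∀ {K} → K ∈ₗ allSubsets n → (B K ∧ (m ⊆ᵇ K) ∧ not (K ⊆ᵇ m)) ≡ false
      no-strict-superset {K} _ with B K in K∈B | m ⊆ᵇ K in m⊆K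
      ... | false | _ = refl
      ... | true | false = refl
      ... | true | true = cong not (trans (cong (_⊆ᵇ m) (sym m≡K)) (⊆ᵇ-refl m))
        where
        K∈candidates : K ∈ₗ candidates
        K∈candidates = ∈-filterᵇ⁺ above-J (∈-allSubsets K)
          (subst (λ b → b ∧ (J ⊆ᵇ K) ≡ true) (sym K∈B) (⊆⇒⊆ᵇ (Subsetₚ.⊆-trans J⊆m (⊆ᵇ⇒⊆ m⊆K))))
        m≡K : m ≡ K
        m≡K = ⊆∧∣q∣≤∣p∣⇒≡ (⊆ᵇ⇒⊆ m⊆K) (proj₂ (proj₂ largest) K∈candidates)

  record IsNested (L : List (Subset n)) : Set where
    field
      unique : Unique L
      ⊆B : ∀ {J} → J ∈ₗ L → InB J
      cond : nestedCondᵇ B L ≡ true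

  IsNested-resp-⊑ : ∀ {M L} → M ⊑ L → IsNested L → IsNested M
  IsNested-resp-⊑ {M} {L} M⊑L L-nested = record
    { unique = Unique-resp-⊑ M⊑L unique
    ; ⊆B = ⊆B ∘ ∈-resp-⊑ M⊑L
    ; cond = cong₂ _∧_ (pairwiseᵇ-resp-⊑ nestedOrDisjointᵇ M⊑L (proj₁ (∧-true⁻ cond)))
               (all⁺ _ (sublists M) (λ N∈ → all⁻ _ (sublists L) (proj₂ (∧-true⁻ cond))
                                                 (sublists⁺ (⊆-trans (sublists⁻ M N∈) M⊑L))))
    }
    where open IsNested L-nested

  IsNested⇒NestedOrDisjoint : ∀ {L} → IsNested L → ∀ {I J} → I ∈ₗ L → J ∈ₗ L → NestedOrDisjoint I J
  IsNested⇒NestedOrDisjoint {L} L-nested {I} {J} I∈ J∈ with I ≟ˢ J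
  ... | yes refl = inj₁ id
  ... | no I≢J with pairwiseᵇ⁻ nestedOrDisjointᵇ L (proj₁ (∧-true⁻ (IsNested.cond L-nested))) I∈ J∈ I≢J
  ... | inj₁ IJ = nestedOrDisjointᵇ⇒ IJ
  ... | inj₂ JI with nestedOrDisjointᵇ⇒ JI
  ... | inj₁ J⊆I = inj₂ (inj₁ J⊆I)
  ... | inj₂ (inj₁ I⊆J) = inj₁ I⊆J
  ... | inj₂ (inj₂ J∩I≡∅) = inj₂ (inj₂ (trans (disjointᵇ-comm I J) J∩I≡∅))

  IsNested⇒¬disjointUnion : ∀ {L} → IsNested L → ∀ {J K rest} → (J ∷ K ∷ rest) ⊑ L →
    pairwiseᵇ disjointᵇ (J ∷ K ∷ rest) ≡ true → ¬ InB (⋃ (J ∷ K ∷ rest))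
  IsNested⇒¬disjointUnion {L} L-nested M⊑L M-disjoint ⋃M∈B =
    true≢false (trans (sym (all⁻ _ (sublists L) (proj₂ (∧-true⁻ (IsNested.cond L-nested))) (sublists⁺ M⊑L)))
                      (cong₂ (λ b c → not (b ∧ c)) M-disjoint ⋃M∈B))

  ⋃-meeting-∪-InB : ∀ I K → InB I → (∀ {J} → J ∈ₗ K → InB J × disjointᵇ I J ≡ false) → InB (⋃ K ∪ I)
  ⋃-meeting-∪-InB I [] I∈B _ = subst InB (sym (Subsetₚ.∪-identityˡ I)) I∈B
  ⋃-meeting-∪-InB I (J ∷ K) I∈B h = subst InB (sym (Subsetₚ.∪-assoc J (⋃ K) I))
    (union-closed J (⋃ K ∪ I) J∈B (⋃-meeting-∪-InB I K I∈B (h ∘ there)) J∩[⋃K∪I]≢∅)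
    where
    J∈B = proj₁ (h (here refl))
    J∩[⋃K∪I]≢∅ : Nonempty (J ∩ (⋃ K ∪ I))
    J∩[⋃K∪I]≢∅ with x , x∈I∩J ← ¬disjointᵇ⇒Nonempty (proj₂ (h (here refl)))
      with x∈I , x∈J ← Subsetₚ.x∈p∩q⁻ I J x∈I∩J
      = x , Subsetₚ.x∈p∩q⁺ (x∈J , Subsetₚ.x∈p∪q⁺ (inj₂ x∈I))

  disjoint-cover-singleton : ∀ {L} → IsNested L → ∀ {I} → InB I → ∀ K → K ⊑ L → pairwiseᵇ disjointᵇ K ≡ true →
    I ⊆ ⋃ K → InB (⋃ K) → ∃ λ J → J ∈ₗ L × I ⊆ J
  disjoint-cover-singleton L-nested {I} I∈B [] _ _ I⊆⋃K _ with x , x∈I ← nonempty I I∈B =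
    ⊥₀-elim (Subsetₚ.∉⊥ (I⊆⋃K x∈I))
  disjoint-cover-singleton L-nested I∈B (J ∷ []) K⊑L _ I⊆⋃K _ =
    J , ∈-resp-⊑ K⊑L (here refl) , λ x∈I → subst (_ ∈_) (Subsetₚ.∪-identityʳ J) (I⊆⋃K x∈I)
  disjoint-cover-singleton L-nested I∈B (J ∷ K ∷ rest) K⊑L K-disjoint _ ⋃K∈B =
    ⊥₀-elim (IsNested⇒¬disjointUnion L-nested K⊑L K-disjoint ⋃K∈B)

  -- The ⊆-maximal members of L meeting I are pairwise disjoint and their union, which contains I,
  -- lies in B; the nested condition therefore leaves only one of them.
  nested-cover : ∀ {L} → IsNested L → ∀ {I} → InB I → I ⊆ ⋃ L → ∃ λ J → J ∈ₗ L × I ⊆ J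
  nested-cover {L} L-nested {I} I∈B I⊆⋃L =
    disjoint-cover-singleton L-nested I∈B tops tops-⊑ tops-disjoint I⊆⋃tops ⋃tops∈B
    where
    open IsNested L-nested
    meeting = filterᵇ (not ∘ disjointᵇ I) L
    meeting-⊑ : meeting ⊑ L
    meeting-⊑ = filter-⊆ _ L
    tops = maximals meeting
    tops-⊑ : tops ⊑ L
    tops-⊑ = ⊆-trans (maximals-⊑ meeting) meeting-⊑
    tops-meet : ∀ {J} → J ∈ₗ tops → InB J × disjointᵇ I J ≡ false
    tops-meet J∈ with J∈L , meets ← ∈-filterᵇ⁻ _ L (∈-resp-⊑ (maximals-⊑ meeting) J∈)
      = ⊆B J∈L , not-true⁻ meets
    I⊆⋃tops : I ⊆ ⋃ tops
    I⊆⋃tops x∈I with J , J∈L , x∈J ← ∈⋃⁻ L (I⊆⋃L x∈I)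
      with K , K∈ , J⊆K ← ⊆-maximals {T = meeting} (∈-filterᵇ⁺ _ J∈L (cong not (common⇒¬disjointᵇ x∈I x∈J)))
      = ∈⋃⁺ tops K∈ (J⊆K x∈J)
    ⋃tops∈B : InB (⋃ tops)
    ⋃tops∈B = subst InB (Subsetₚ.⊆-antisym ⋃tops∪I⊆⋃tops (Subsetₚ.p⊆p∪q I))
                        (⋃-meeting-∪-InB I tops I∈B tops-meet)
      where
      ⋃tops∪I⊆⋃tops : ⋃ tops ∪ I ⊆ ⋃ tops
      ⋃tops∪I⊆⋃tops x∈ with Subsetₚ.x∈p∪q⁻ (⋃ tops) I x∈
      ... | inj₁ x∈⋃ = x∈⋃
      ... | inj₂ x∈I = I⊆⋃tops x∈I
    tops-disjoint : pairwiseᵇ disjointᵇ tops ≡ true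
    tops-disjoint = maximals-pairwise-disjoint (Unique-resp-⊑ meeting-⊑ unique)
      (λ I∈ J∈ → IsNested⇒NestedOrDisjoint L-nested (∈-resp-⊑ meeting-⊑ I∈) (∈-resp-⊑ meeting-⊑ J∈))

  -- If a largest member I were covered by the others, nested-cover would put it inside one of them.
  ⋃-drop-largest : ∀ ys I zs → IsNested (ys ++ I ∷ zs) → (∀ {J} → J ∈ₗ ys ++ I ∷ zs → ∣ J ∣ ≤ ∣ I ∣) →
    ∣ ⋃ (ys ++ zs) ∣ < ∣ ⋃ (ys ++ I ∷ zs) ∣
  ⋃-drop-largest ys I zs L-nested I-largest =
    ℕₚ.≤-trans (⊈ᵇ⇒∣q∣<∣p∪q∣ I (⋃ L′) I⊈⋃L′) (Subsetₚ.p⊆q⇒∣p∣≤∣q∣ I∪⋃L′⊆⋃L)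
    where
    L′ = ys ++ zs
    L′⊑L = ++-∷-⊒ ys I zs
    I∉L′ : I ∉ₗ L′
    I∉L′ I∈L′ with ∈-++⁻ ys I∈L′ | Unique-∉-middle ys (IsNested.unique L-nested)
    ... | inj₁ I∈ys | I∉ys , _ = I∉ys I∈ys
    ... | inj₂ I∈zs | _ , I∉zs = I∉zs I∈zs
    I⊈⋃L′ : (I ⊆ᵇ ⋃ L′) ≡ false
    I⊈⋃L′ with I ⊆ᵇ ⋃ L′ in I⊆⋃L′
    ... | false = refl
    ... | true with J , J∈L′ , I⊆J ← nested-cover (IsNested-resp-⊑ L′⊑L L-nested)
                                       (IsNested.⊆B L-nested (∈-++⁺ʳ ys (here refl))) (⊆ᵇ⇒⊆ I⊆⋃L′)
      = ⊥₀-elim (I∉L′ (subst (_∈ₗ L′) (sym (⊆∧∣q∣≤∣p∣⇒≡ I⊆J (I-largest (∈-resp-⊑ L′⊑L J∈L′)))) J∈L′))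
    I∪⋃L′⊆⋃L : I ∪ ⋃ L′ ⊆ ⋃ (ys ++ I ∷ zs)
    I∪⋃L′⊆⋃L x∈ with Subsetₚ.x∈p∪q⁻ I (⋃ L′) x∈
    ... | inj₁ x∈I = ∈⋃⁺ (ys ++ I ∷ zs) (∈-++⁺ʳ ys (here refl)) x∈I
    ... | inj₂ x∈⋃L′ with J , J∈L′ , x∈J ← ∈⋃⁻ L′ x∈⋃L′ = ∈⋃⁺ (ys ++ I ∷ zs) (∈-resp-⊑ L′⊑L J∈L′) x∈J

  nested-length≤∣⋃∣ : ∀ {L} → IsNested L → length L ≤ ∣ ⋃ L ∣
  nested-length≤∣⋃∣ {L} = bounded (length L) ℕₚ.≤-refl
    where
    bounded : ∀ k {L} → length L ≤ k → IsNested L → length L ≤ ∣ ⋃ L ∣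
    bounded _ {[]} _ _ = z≤n
    bounded (suc k) {L@(_ ∷ _)} len≤ L-nested
      with I , I∈L , I-largest ← argmax ∣_∣ L (here refl)
      with ys , zs , L≡ ← ∈-∃++ I∈L
      = subst (λ M → length M ≤ ∣ ⋃ M ∣) (sym L≡) (begin
          length (ys ++ I ∷ zs)       ≡⟨ length-++-∷ ys I zs ⟩
          suc (length (ys ++ zs))     ≤⟨ s≤s (bounded k len′≤ (IsNested-resp-⊑ (++-∷-⊒ ys I zs) L-split-nested)) ⟩
          suc ∣ ⋃ (ys ++ zs) ∣        ≤⟨ ⋃-drop-largest ys I zs L-split-nested I-largest′ ⟩
          ∣ ⋃ (ys ++ I ∷ zs) ∣        ∎)
      where
      open ℕₚ.≤-Reasoning
      L-split-nested : IsNested (ys ++ I ∷ zs)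
      L-split-nested = subst IsNested L≡ L-nested
      I-largest′ : ∀ {J} → J ∈ₗ ys ++ I ∷ zs → ∣ J ∣ ≤ ∣ I ∣
      I-largest′ {J} J∈ = I-largest (subst (J ∈ₗ_) (sym L≡) J∈)
      len′≤ : length (ys ++ zs) ≤ k
      len′≤ = ℕₚ.≤-pred (subst (_≤ suc k) (trans (cong length L≡) (length-++-∷ ys I zs)) len≤)

  isMax-NestedOrDisjoint : ∀ {I J} → InB I → InB J → isMax I ≡ true ⊎ isMax J ≡ true → NestedOrDisjoint I J
  isMax-NestedOrDisjoint {I} {J} _ J∈B (inj₁ I-max) with disjointᵇ I J in I∩J
  ... | true = inj₂ (inj₂ refl)
  ... | false = inj₂ (inj₁ (isMax-absorbs I-max J∈B I∩J))
  isMax-NestedOrDisjoint {I} {J} I∈B _ (inj₂ J-max) with disjointᵇ J I in J∩I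
  ... | true = inj₂ (inj₂ (trans (disjointᵇ-comm I J) J∩I))
  ... | false = inj₁ (isMax-absorbs J-max I∈B J∩I)

  nestedCond-nonMax : ∀ L → (∀ {J} → J ∈ₗ L → InB J) →
    nestedCondᵇ B L ≡ nestedCondᵇ B (filterᵇ (not ∘ isMax) L)
  nestedCond-nonMax L L⊆B = cong₂ _∧_
    (pairwiseᵇ-filterᵇ-irrelevant nestedOrDisjointᵇ isMax L λ I∈ J∈ →
      ⇒nestedOrDisjointᵇ ∘ isMax-NestedOrDisjoint (L⊆B I∈) (L⊆B J∈))
    (all-sublists-filterᵇ-irrelevant isMax _ L no-union-with-max)
    where
    no-union-with-max : ∀ {M} → M ⊑ L → any isMax M ≡ true →
      not ((2 ≤ᵇ length M) ∧ pairwiseᵇ disjointᵇ M ∧ B (⋃ M)) ≡ true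
    no-union-with-max {M} M⊑L has-max
      with m , m∈M , m-max ← any-true⁻ isMax M has-max
      with 2 ≤ᵇ length M in 2≤ | pairwiseᵇ disjointᵇ M in M-disjoint | B (⋃ M) in ⋃M∈B
    ... | false | _ | _ = refl
    ... | true | false | _ = refl
    ... | true | true | false = refl
    ... | true | true | true = ⊥₀-elim (disjointᵇ⇒∉ m∩J≡∅ (subst (x ∈_) ⋃M≡m (∈⋃⁺ M J∈M x∈J)) x∈J)
      where
      partner = pairwiseᵇ-partner disjointᵇ M M-disjoint m∈M (ℕₚ.≤ᵇ⇒≤ 2 (length M) (Equivalence.from T-≡ 2≤))
      J = proj₁ partner
      J∈M = proj₁ (proj₂ partner)
      m∩J≡∅ : disjointᵇ m J ≡ true
      m∩J≡∅ with proj₂ (proj₂ partner)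
      ... | inj₁ m∩J = m∩J
      ... | inj₂ J∩m = trans (disjointᵇ-comm m J) J∩m
      ⋃M≡m : ⋃ M ≡ m
      ⋃M≡m = isMax-⊆⇒≡ m-max ⋃M∈B (∈⋃⁺ M m∈M)
      x = proj₁ (nonempty J (L⊆B (∈-resp-⊑ M⊑L J∈M)))
      x∈J = proj₂ (nonempty J (L⊆B (∈-resp-⊑ M⊑L J∈M)))

  maximal = filterᵇ isMax (members B)
  nonMaximal = filterᵇ (not ∘ isMax) (members B)

  length-maximal : length maximal ≡ maxCount B
  length-maximal = cong length (filterᵇ-filterᵇ B isMax (allSubsets n) isMax⇒InB)

  maximal-Unique : Unique maximal
  maximal-Unique = Unique-resp-⊑ (filter-⊆ _ (members B)) members-Unique

  ∈maximal⁻ : ∀ {J} → J ∈ₗ maximal → isMax J ≡ true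
  ∈maximal⁻ J∈ = proj₂ (∈-filterᵇ⁻ isMax (members B) J∈)

  ∈nonMaximal⁻ : ∀ {C J} → C ∈ₗ sublists nonMaximal → J ∈ₗ C → isMax J ≡ false
  ∈nonMaximal⁻ C∈ J∈ = not-true⁻ (proj₂ (∈-filterᵇ⁻ _ (members B) (∈-resp-⊑ (sublists⁻ nonMaximal C∈) J∈)))

  sublist-members-IsNested : ∀ {L} → L ⊑ members B → nestedCondᵇ B L ≡ true → IsNested L
  sublist-members-IsNested L⊑ cond = record
    { unique = Unique-resp-⊑ L⊑ members-Unique ; ⊆B = ∈members⁻ ∘ ∈-resp-⊑ L⊑ ; cond = cond }

  nonMaximal-IsNested : ∀ {C} → C ∈ₗ sublists nonMaximal → nestedCondᵇ B C ≡ true → IsNested C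
  nonMaximal-IsNested C∈ = sublist-members-IsNested (⊆-trans (sublists⁻ nonMaximal C∈) (filter-⊆ _ (members B)))

  nonMaximal-length-bound : ∀ {C} → C ∈ₗ sublists nonMaximal → nestedCondᵇ B C ≡ true →
    length C ℕ.+ length maximal ≤ n
  nonMaximal-length-bound {C} C∈ C-cond = begin
    length C ℕ.+ length maximal ≡⟨ sym (Listₚ.length-++ C) ⟩
    length (C ++ maximal)       ≤⟨ nested-length≤∣⋃∣ C++maximal-nested ⟩
    ∣ ⋃ (C ++ maximal) ∣         ≤⟨ Subsetₚ.∣p∣≤n (⋃ (C ++ maximal)) ⟩
    n                           ∎
    where
    open ℕₚ.≤-Reasoning
    C++maximal-nested : IsNested (C ++ maximal)
    C++maximal-nested = record
      { unique = Uniqueₚ.++⁺ (IsNested.unique (nonMaximal-IsNested C∈ C-cond)) maximal-Unique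
                   (λ (J∈C , J∈max) → true≢false (trans (sym (∈maximal⁻ J∈max)) (∈nonMaximal⁻ C∈ J∈C)))
      ; ⊆B = C++maximal⊆B
      ; cond = trans (nestedCond-nonMax (C ++ maximal) C++maximal⊆B) (trans (cong (nestedCondᵇ B) only-C) C-cond)
      }
      where
      C++maximal⊆B : ∀ {J} → J ∈ₗ C ++ maximal → InB J
      C++maximal⊆B J∈ = [ IsNested.⊆B (nonMaximal-IsNested C∈ C-cond) , isMax⇒InB ∘ ∈maximal⁻ ]′ (∈-++⁻ C J∈)
      only-C : filterᵇ (not ∘ isMax) (C ++ maximal) ≡ C
      only-C = trans (Listₚ.filter-++ (T? ∘ (not ∘ isMax)) C maximal)
                     (trans (cong₂ _++_ (filterᵇ-all _ C (cong not ∘ ∈nonMaximal⁻ C∈))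
                                        (filterᵇ-none _ maximal (cong not ∘ ∈maximal⁻)))
                            (Listₚ.++-identityʳ C))

  covers : List (Subset n) → List (Subset n) → Bool
  covers C X = ∣ ⋃ X ∪ ⋃ C ∣ ≡ᵇ n

  maximal-covers : ∀ C → covers C maximal ≡ true
  maximal-covers C = Equivalence.to T-≡ (ℕₚ.≡⇒≡ᵇ _ n (trans (cong ∣_∣ ⋃maximal∪⋃C≡⊤) (Subsetₚ.∣⊤∣≡n n)))
    where
    ⋃maximal∪⋃C≡⊤ : ⋃ maximal ∪ ⋃ C ≡ ⊤
    ⋃maximal∪⋃C≡⊤ = Subsetₚ.⊆-antisym Subsetₚ.⊆⊤ λ {x} _ →
      let m , m-max , ⁅x⁆⊆m = ⊆-isMax (singletons x)
      in Subsetₚ.x∈p∪q⁺ (inj₁ (∈⋃⁺ maximal (∈-filterᵇ⁺ isMax (∈members⁺ (isMax⇒InB m-max)) m-max)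
                                            (⁅x⁆⊆m (Subsetₚ.x∈⁅x⁆ x))))

  -- A maximal element missed by X meets no member of X, so it lies in ⋃ C and hence, by
  -- nested-cover, inside a non-maximal member of C.
  covers-needs-every-maximal : ∀ {C X m} → C ∈ₗ sublists nonMaximal → nestedCondᵇ B C ≡ true →
    X ⊑ maximal → m ∈ₗ maximal → m ∉ₗ X → covers C X ≡ false
  covers-needs-every-maximal {C} {X} {m} C∈ C-cond X⊑ m∈ m∉X with covers C X in covered
  ... | false = refl
  ... | true = ⊥₀-elim (m-not-below-C (nested-cover C-nested (isMax⇒InB m-max) m⊆⋃C))
    where
    m-max : isMax m ≡ true
    m-max = ∈maximal⁻ m∈
    C-nested = nonMaximal-IsNested C∈ C-cond
    m-not-below-C : ¬ ∃ λ J → J ∈ₗ C × m ⊆ J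
    m-not-below-C (J , J∈C , m⊆J) = true≢false (trans (sym m-max)
      (trans (cong isMax (sym (isMax-⊆⇒≡ m-max (IsNested.⊆B C-nested J∈C) m⊆J))) (∈nonMaximal⁻ C∈ J∈C)))
    ⋃X∪⋃C≡⊤ : ⋃ X ∪ ⋃ C ≡ ⊤
    ⋃X∪⋃C≡⊤ = Subsetₚ.∣p∣≡n⇒p≡⊤ (ℕₚ.≡ᵇ⇒≡ _ n (Equivalence.from T-≡ covered))
    m⊆⋃C : m ⊆ ⋃ C
    m⊆⋃C {x} x∈m with Subsetₚ.x∈p∪q⁻ (⋃ X) (⋃ C) (subst (x ∈_) (sym ⋃X∪⋃C≡⊤) Subsetₚ.∈⊤)
    ... | inj₂ x∈⋃C = x∈⋃C
    ... | inj₁ x∈⋃X with y , y∈X , x∈y ← ∈⋃⁻ X x∈⋃X =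
      ⊥₀-elim (m∉X (subst (_∈ₗ X) y≡m y∈X))
      where
      y-max = ∈maximal⁻ (∈-resp-⊑ X⊑ y∈X)
      y≡m : y ≡ m
      y≡m = isMax-⊆⇒≡ m-max (isMax⇒InB y-max)
              (isMax-absorbs y-max (isMax⇒InB m-max) (common⇒¬disjointᵇ x∈y x∈m))

  ∑-covers : ∀ {C} → C ∈ₗ sublists nonMaximal → nestedCondᵇ B C ≡ true → (w : ℕ → ℤ) →
    ∑ (sublists maximal) (λ X → ind (covers C X) (w (length X))) ≡ w (length maximal)
  ∑-covers {C} C∈ C-cond w = trans
    (∑-sublists-complete maximal-Unique _ λ {X} X⊑ m∈ m∉X →
      cong (λ b → ind b (w (length X))) (covers-needs-every-maximal C∈ C-cond X⊑ m∈ m∉X))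
    (cong (λ b → ind b (w (length maximal))) (maximal-covers C))

-- The expansions of both sides

module Expansion {n : ℕ} (B : Subset n → Bool) (isBuildingSet : IsBuildingSet B) (t : ℤ) where

  open BuildingSetProperties B isBuildingSet

  -- The contribution of L to f_{P□(B|_S)}(t), once the formal symbols R ⊆ S ∖ ⋃ L are summed out.
  weight : List (Subset n) → Subset n → ℤ
  weight L S = ind ((⋃ L ⊆ᵇ S) ∧ nestedCondᵇ B L) (t ^ (∣ ⋃ L ∣ ∸ length L) * (t + 1ℤ) ^ (∣ S ∣ ∸ ∣ ⋃ L ∣))

  nestedTerm : ℤ → List (Subset n) → ℤ
  nestedTerm c L = ind (nestedCondᵇ B L) (t ^ (∣ ⋃ L ∣ ∸ length L) * c ^ (n ∸ ∣ ⋃ L ∣))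

  members-IsNested : ∀ {L} → L ∈ₗ sublists (members B) → nestedCondᵇ B L ≡ true → IsNested L
  members-IsNested L∈ = sublist-members-IsNested (sublists⁻ (members B) L∈)

  module _ (S : Subset n) where

    extended : List (Subset n) × Subset n → Bool
    extended (L , R) = nestedCondᵇ (restrict B S) L ∧ ((R ⊆ᵇ S) ∧ all (disjointᵇ R) L)

    ∑-symbols : List (Subset n) → ℤ
    ∑-symbols L = ∑ (allSubsets n) (λ R → ind (extended (L , R)) (t ^ (∣ S ∣ ∸ (length L ℕ.+ ∣ R ∣))))

    sublists-members-restrict : sublists (members (restrict B S)) ≡ filterᵇ (all (_⊆ᵇ S)) (sublists (members B))
    sublists-members-restrict =
      trans (cong sublists (filterᵇ-∧ B (_⊆ᵇ S) (allSubsets n))) (sublists-filterᵇ (_⊆ᵇ S) (members B))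

    extended-size≤ : ∀ {x} → x ∈ₗ cartesianProduct (sublists (members (restrict B S))) (allSubsets n) →
      extended x ≡ true → length (proj₁ x) ℕ.+ ∣ proj₂ x ∣ ≤ ∣ S ∣
    extended-size≤ {L , R} x∈ x-ext = begin
      length L ℕ.+ ∣ R ∣       ≤⟨ ℕₚ.+-monoˡ-≤ ∣ R ∣ (nested-length≤∣⋃∣ L-nested) ⟩
      ∣ ⋃ L ∣ ℕ.+ ∣ R ∣         ≡⟨ ℕₚ.+-comm ∣ ⋃ L ∣ ∣ R ∣ ⟩
      ∣ R ∣ ℕ.+ ∣ ⋃ L ∣         ≡⟨ sym (∣∪∣-disjoint R (⋃ L) R∩⋃L≡∅) ⟩
      ∣ R ∪ ⋃ L ∣               ≤⟨ ⊆ᵇ⇒∣p∣≤∣q∣ (R ∪ ⋃ L) S (trans (∪-⊆ᵇ R (⋃ L) S) (cong₂ _∧_ R⊆S ⋃L⊆S)) ⟩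
      ∣ S ∣                     ∎
      where
      open ℕₚ.≤-Reasoning
      L∈ = subst (L ∈ₗ_) sublists-members-restrict (proj₁ (∈-cartesianProduct⁻ _ _ x∈))
      L∈′ = proj₁ (∈-filterᵇ⁻ (all (_⊆ᵇ S)) (sublists (members B)) L∈)
      L⊆S = proj₂ (∈-filterᵇ⁻ (all (_⊆ᵇ S)) (sublists (members B)) L∈)
      ⋃L⊆S = trans (sym (all-⊆ᵇ-⋃ L S)) L⊆S
      cond = ∧-true⁻ x-ext
      R⊆S = proj₁ (∧-true⁻ (proj₂ cond))
      R∩⋃L≡∅ = trans (sym (all-disjointᵇ-⋃ L R)) (proj₂ (∧-true⁻ (proj₂ cond)))
      L-nested = members-IsNested L∈′ (trans (sym (nestedCond-restrict B S L L⊆S)) (proj₁ cond))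

    ∑-symbols-inside : ∀ {L} → L ∈ₗ sublists (members B) → (⋃ L ⊆ᵇ S) ≡ true →
      ∑-symbols L ≡ ind (nestedCondᵇ B L) (t ^ (∣ ⋃ L ∣ ∸ length L) * (t + 1ℤ) ^ (∣ S ∣ ∸ ∣ ⋃ L ∣))
    ∑-symbols-inside {L} L∈ ⋃L⊆S = begin
      ∑-symbols L
        ≡⟨ ∑-cong (allSubsets n) (λ R → trans (cong₂ (λ b c → ind (b ∧ ((R ⊆ᵇ S) ∧ c)) (term R))
                                                      (nestedCond-restrict B S L L⊆S) (all-disjointᵇ-⋃ L R))
                                               (ind-∧ (nestedCondᵇ B L) _ _)) ⟩
      ∑ (allSubsets n) (λ R → ind (nestedCondᵇ B L) (ind ((R ⊆ᵇ S) ∧ disjointᵇ R (⋃ L)) (term R)))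
        ≡⟨ ∑-ind (allSubsets n) (nestedCondᵇ B L) _ ⟩
      ind (nestedCondᵇ B L) (∑ (allSubsets n) (λ R → ind ((R ⊆ᵇ S) ∧ disjointᵇ R (⋃ L)) (term R)))
        ≡⟨ count-symbols (nestedCondᵇ B L) refl ⟩
      ind (nestedCondᵇ B L) (t ^ (∣ ⋃ L ∣ ∸ length L) * (t + 1ℤ) ^ (∣ S ∣ ∸ ∣ ⋃ L ∣)) ∎
      where
      open ≡-Reasoning
      term : Subset n → ℤ
      term R = t ^ (∣ S ∣ ∸ (length L ℕ.+ ∣ R ∣))
      L⊆S = trans (all-⊆ᵇ-⋃ L S) ⋃L⊆S
      count-symbols : ∀ c → nestedCondᵇ B L ≡ c →
        ind c (∑ (allSubsets n) (λ R → ind ((R ⊆ᵇ S) ∧ disjointᵇ R (⋃ L)) (term R)))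
          ≡ ind c (t ^ (∣ ⋃ L ∣ ∸ length L) * (t + 1ℤ) ^ (∣ S ∣ ∸ ∣ ⋃ L ∣))
      count-symbols false _ = refl
      count-symbols true L-cond =
        trans (∑-cong (allSubsets n) (λ R → cong (λ e → ind ((R ⊆ᵇ S) ∧ disjointᵇ R (⋃ L)) (t ^ e)) (exponent R)))
              (∑-disjoint-subsets n S (⋃ L) t ⋃L⊆S (∣ ⋃ L ∣ ∸ length L))
        where
        exponent : ∀ R → ∣ S ∣ ∸ (length L ℕ.+ ∣ R ∣) ≡ ((∣ ⋃ L ∣ ∸ length L) ℕ.+ (∣ S ∣ ∸ ∣ ⋃ L ∣)) ∸ ∣ R ∣
        exponent R = trans (sym (ℕₚ.∸-+-assoc (∣ S ∣) (length L) (∣ R ∣)))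
                           (cong (_∸ ∣ R ∣) (∸-split (nested-length≤∣⋃∣ (members-IsNested L∈ L-cond))
                                                     (⊆ᵇ⇒∣p∣≤∣q∣ (⋃ L) S ⋃L⊆S)))

    ∑-symbols-weight : ∀ {L} → L ∈ₗ sublists (members B) → ind (all (_⊆ᵇ S) L) (∑-symbols L) ≡ weight L S
    ∑-symbols-weight {L} L∈ rewrite all-⊆ᵇ-⋃ L S with ⋃ L ⊆ᵇ S in ⋃L⊆S
    ... | false = refl
    ... | true = ∑-symbols-inside L∈ ⋃L⊆S

    fExt-restrict : fExt (restrict B S) S t ≡ ∑ (sublists (members B)) (λ L → weight L S)
    fExt-restrict = begin
      fExt (restrict B S) S t
        ≡⟨ polyEval-count ∣ S ∣ t pairs extended size (extCount (restrict B S) S) count-by-size extended-size≤ ⟩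
      ∑ pairs (λ x → ind (extended x) (t ^ (∣ S ∣ ∸ size x)))
        ≡⟨ ∑-cartesianProduct (sublists (members (restrict B S))) (allSubsets n) _ ⟩
      ∑ (sublists (members (restrict B S))) ∑-symbols
        ≡⟨ cong (λ Ls → ∑ Ls ∑-symbols) sublists-members-restrict ⟩
      ∑ (filterᵇ (all (_⊆ᵇ S)) (sublists (members B))) ∑-symbols
        ≡⟨ ∑-filterᵇ (sublists (members B)) (all (_⊆ᵇ S)) ∑-symbols ⟩
      ∑ (sublists (members B)) (λ L → ind (all (_⊆ᵇ S) L) (∑-symbols L))
        ≡⟨ ∑-cong-∈ (sublists (members B)) ∑-symbols-weight ⟩
      ∑ (sublists (members B)) (λ L → weight L S) ∎
      where
      open ≡-Reasoning
      pairs = cartesianProduct (sublists (members (restrict B S))) (allSubsets n)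
      size : List (Subset n) × Subset n → ℕ
      size (L , R) = length L ℕ.+ ∣ R ∣
      count-by-size : ∀ k → extCount (restrict B S) S k ≡ length (filterᵇ (λ x → extended x ∧ (size x ≡ᵇ k)) pairs)
      count-by-size k = cong length (filterᵇ-cong _ _ pairs λ (L , R) →
        sym (trans (Boolₚ.∧-assoc (nestedCondᵇ (restrict B S) L) _ _)
                   (cong (nestedCondᵇ (restrict B S) L ∧_) (Boolₚ.∧-assoc (R ⊆ᵇ S) _ _))))

  ∑-subsets-fExt : ∀ a → ∑ (allSubsets n) (λ S → a ^ (n ∸ ∣ S ∣) * fExt (restrict B S) S t)
    ≡ ∑ (sublists (members B)) (nestedTerm (a + (t + 1ℤ)))
  ∑-subsets-fExt a = begin
    ∑ (allSubsets n) (λ S → a ^ (n ∸ ∣ S ∣) * fExt (restrict B S) S t)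
      ≡⟨ ∑-cong (allSubsets n) (λ S → trans (cong (a ^ (n ∸ ∣ S ∣) *_) (fExt-restrict S))
                                            (sym (∑-*ˡ (sublists (members B)) (a ^ (n ∸ ∣ S ∣)) (λ L → weight L S)))) ⟩
    ∑ (allSubsets n) (λ S → ∑ (sublists (members B)) (λ L → a ^ (n ∸ ∣ S ∣) * weight L S))
      ≡⟨ ∑-comm (allSubsets n) (sublists (members B)) _ ⟩
    ∑ (sublists (members B)) (λ L → ∑ (allSubsets n) (λ S → a ^ (n ∸ ∣ S ∣) * weight L S))
      ≡⟨ ∑-cong (sublists (members B)) ∑-supersets-weight ⟩
    ∑ (sublists (members B)) (nestedTerm (a + (t + 1ℤ))) ∎
    where
    open ≡-Reasoning
    ind-rearrange : ∀ u c (A X Y : ℤ) → A * ind (u ∧ c) (X * Y) ≡ ind c (X * ind u (A * Y))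
    ind-rearrange true true A X Y = swap A X Y
      where
      swap : ∀ A X Y → A * (X * Y) ≡ X * (A * Y)
      swap = solve-∀
    ind-rearrange true false A X Y = ℤₚ.*-zeroʳ A
    ind-rearrange false true A X Y = trans (ℤₚ.*-zeroʳ A) (sym (ℤₚ.*-zeroʳ X))
    ind-rearrange false false A X Y = ℤₚ.*-zeroʳ A
    ∑-supersets-weight : ∀ L → ∑ (allSubsets n) (λ S → a ^ (n ∸ ∣ S ∣) * weight L S) ≡ nestedTerm (a + (t + 1ℤ)) L
    ∑-supersets-weight L = begin
      ∑ (allSubsets n) (λ S → a ^ (n ∸ ∣ S ∣) * weight L S)
        ≡⟨ ∑-cong (allSubsets n) (λ S → ind-rearrange (⋃ L ⊆ᵇ S) (nestedCondᵇ B L) (a ^ (n ∸ ∣ S ∣)) X (Y S)) ⟩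
      ∑ (allSubsets n) (λ S → ind (nestedCondᵇ B L) (X * ind (⋃ L ⊆ᵇ S) (a ^ (n ∸ ∣ S ∣) * Y S)))
        ≡⟨ ∑-ind (allSubsets n) (nestedCondᵇ B L) _ ⟩
      ind (nestedCondᵇ B L) (∑ (allSubsets n) (λ S → X * ind (⋃ L ⊆ᵇ S) (a ^ (n ∸ ∣ S ∣) * Y S)))
        ≡⟨ cong (ind (nestedCondᵇ B L))
                (trans (∑-*ˡ (allSubsets n) X _) (cong (X *_) (∑-supersets-binomial n (⋃ L) a (t + 1ℤ)))) ⟩
      ind (nestedCondᵇ B L) (X * (a + (t + 1ℤ)) ^ (n ∸ ∣ ⋃ L ∣)) ∎
      where
      X = t ^ (∣ ⋃ L ∣ ∸ length L)
      Y = λ S → (t + 1ℤ) ^ (∣ S ∣ ∸ ∣ ⋃ L ∣)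

  d : ℕ
  d = n ∸ maxCount B

  fNest-expansion : fNest B t ≡ ∑ (sublists nonMaximal) (λ C → ind (nestedCondᵇ B C) (t ^ (d ∸ length C)))
  fNest-expansion = polyEval-count d t (sublists nonMaximal) (nestedCondᵇ B) length (nestedCount B) (λ _ → refl)
    λ {C} C∈ C-cond → subst (λ m → length C ≤ n ∸ m) length-maximal
                              (ℕₚ.m+n≤o⇒m≤o∸n (length C) (nonMaximal-length-bound C∈ C-cond))

  ∑-members-split : ∀ (h : List (Subset n) → ℤ) (G : List (Subset n) → List (Subset n) → ℤ) →
    (∀ {L} → L ∈ₗ sublists (members B) → h L ≡ G (filterᵇ isMax L) (filterᵇ (not ∘ isMax) L)) →
    ∑ (sublists (members B)) h ≡ ∑ (sublists nonMaximal) (λ C → ∑ (sublists maximal) (λ X → G X C))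
  ∑-members-split h G h≡G = begin
    ∑ (sublists (members B)) h
      ≡⟨ ∑-cong-∈ (sublists (members B)) h≡G ⟩
    ∑ (sublists (members B)) (λ L → G (filterᵇ isMax L) (filterᵇ (not ∘ isMax) L))
      ≡⟨ ∑-sublists-partition isMax (members B) G ⟩
    ∑ (sublists maximal) (λ X → ∑ (sublists nonMaximal) (G X))
      ≡⟨ ∑-comm (sublists maximal) (sublists nonMaximal) G ⟩
    ∑ (sublists nonMaximal) (λ C → ∑ (sublists maximal) (λ X → G X C)) ∎
    where open ≡-Reasoning

  nestedCond-split : ∀ {L} → L ∈ₗ sublists (members B) → nestedCondᵇ B L ≡ nestedCondᵇ B (filterᵇ (not ∘ isMax) L)
  nestedCond-split {L} L∈ = nestedCond-nonMax L (∈members⁻ ∘ ∈-resp-⊑ (sublists⁻ (members B) L∈))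

  identity-unsigned : (t + 1ℤ) ^ maxCount B * fNest B t
    ≡ ∑ (allSubsets n) (λ S → (- 1ℤ) ^ (n ∸ ∣ S ∣) * fExt (restrict B S) S t)
  identity-unsigned = sym (begin
    ∑ (allSubsets n) (λ S → (- 1ℤ) ^ (n ∸ ∣ S ∣) * fExt (restrict B S) S t)
      ≡⟨ ∑-subsets-fExt (- 1ℤ) ⟩
    ∑ (sublists (members B)) (nestedTerm (- 1ℤ + (t + 1ℤ)))
      ≡⟨ ∑-members-split _ G per-collection ⟩
    ∑ (sublists nonMaximal) (λ C → ∑ (sublists maximal) (λ X → G X C))
      ≡⟨ ∑-cong-∈ (sublists nonMaximal) ∑-maximal ⟩
    ∑ (sublists nonMaximal) (λ C → (t + 1ℤ) ^ maxCount B * ind (nestedCondᵇ B C) (t ^ (d ∸ length C)))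
      ≡⟨ ∑-*ˡ (sublists nonMaximal) ((t + 1ℤ) ^ maxCount B) _ ⟩
    (t + 1ℤ) ^ maxCount B * ∑ (sublists nonMaximal) (λ C → ind (nestedCondᵇ B C) (t ^ (d ∸ length C)))
      ≡⟨ cong ((t + 1ℤ) ^ maxCount B *_) (sym fNest-expansion) ⟩
    (t + 1ℤ) ^ maxCount B * fNest B t ∎)
    where
    open ≡-Reasoning
    G : List (Subset n) → List (Subset n) → ℤ
    G X C = ind (nestedCondᵇ B C) (t ^ (n ∸ (length X ℕ.+ length C)))
    per-collection : ∀ {L} → L ∈ₗ sublists (members B) →
      nestedTerm (- 1ℤ + (t + 1ℤ)) L ≡ G (filterᵇ isMax L) (filterᵇ (not ∘ isMax) L)
    per-collection {L} L∈ = trans powers-merge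
      (cong₂ (λ b e → ind b (t ^ (n ∸ e))) (nestedCond-split L∈) (length-partitionᵇ isMax L))
      where
      powers-merge : nestedTerm (- 1ℤ + (t + 1ℤ)) L ≡ ind (nestedCondᵇ B L) (t ^ (n ∸ length L))
      powers-merge with nestedCondᵇ B L in L-cond
      ... | false = refl
      ... | true = begin
        t ^ (∣ ⋃ L ∣ ∸ length L) * (- 1ℤ + (t + 1ℤ)) ^ (n ∸ ∣ ⋃ L ∣)
          ≡⟨ cong (λ b → t ^ (∣ ⋃ L ∣ ∸ length L) * b ^ (n ∸ ∣ ⋃ L ∣)) (-1+[t+1]≡t t) ⟩
        t ^ (∣ ⋃ L ∣ ∸ length L) * t ^ (n ∸ ∣ ⋃ L ∣)
          ≡⟨ sym (ℤₚ.^-distribˡ-+-* t (∣ ⋃ L ∣ ∸ length L) (n ∸ ∣ ⋃ L ∣)) ⟩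
        t ^ ((∣ ⋃ L ∣ ∸ length L) ℕ.+ (n ∸ ∣ ⋃ L ∣))
          ≡⟨ cong (t ^_) (sym (∸-split (nested-length≤∣⋃∣ (members-IsNested L∈ L-cond)) (Subsetₚ.∣p∣≤n (⋃ L)))) ⟩
        t ^ (n ∸ length L) ∎
        where
        -1+[t+1]≡t : ∀ t → - 1ℤ + (t + 1ℤ) ≡ t
        -1+[t+1]≡t = solve-∀
    ∑-maximal : ∀ {C} → C ∈ₗ sublists nonMaximal →
      ∑ (sublists maximal) (λ X → G X C) ≡ (t + 1ℤ) ^ maxCount B * ind (nestedCondᵇ B C) (t ^ (d ∸ length C))
    ∑-maximal {C} C∈ = trans (∑-ind (sublists maximal) (nestedCondᵇ B C) _)
      (trans by-cond (ind-*ˡ (nestedCondᵇ B C) ((t + 1ℤ) ^ maxCount B) (t ^ (d ∸ length C))))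
      where
      by-cond : ind (nestedCondᵇ B C) (∑ (sublists maximal) (λ X → t ^ (n ∸ (length X ℕ.+ length C))))
                  ≡ ind (nestedCondᵇ B C) ((t + 1ℤ) ^ maxCount B * t ^ (d ∸ length C))
      by-cond with nestedCondᵇ B C in C-cond
      ... | false = refl
      ... | true = begin
        ∑ (sublists maximal) (λ X → t ^ (n ∸ (length X ℕ.+ length C)))
          ≡⟨ ∑-cong (sublists maximal) (λ X → cong (t ^_)
               (exponent-shift (length X) (length C) (length maximal) (nonMaximal-length-bound C∈ C-cond))) ⟩
        ∑ (sublists maximal) (λ X → t ^ ((((n ∸ length maximal) ∸ length C) ℕ.+ length maximal) ∸ length X))
          ≡⟨ ∑-sublists-power t maximal ((n ∸ length maximal) ∸ length C) ⟩
        t ^ ((n ∸ length maximal) ∸ length C) * (t + 1ℤ) ^ length maximal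
          ≡⟨ cong (λ m → t ^ ((n ∸ m) ∸ length C) * (t + 1ℤ) ^ m) length-maximal ⟩
        t ^ (d ∸ length C) * (t + 1ℤ) ^ maxCount B
          ≡⟨ ℤₚ.*-comm (t ^ (d ∸ length C)) _ ⟩
        (t + 1ℤ) ^ maxCount B * t ^ (d ∸ length C) ∎

  identity-signed : fNest B t ≡ ∑ (allSubsets n) (λ S → (- t - 1ℤ) ^ (n ∸ ∣ S ∣) * fExt (restrict B S) S t)
  identity-signed = sym (begin
    ∑ (allSubsets n) (λ S → (- t - 1ℤ) ^ (n ∸ ∣ S ∣) * fExt (restrict B S) S t)
      ≡⟨ ∑-subsets-fExt (- t - 1ℤ) ⟩
    ∑ (sublists (members B)) (nestedTerm ((- t - 1ℤ) + (t + 1ℤ)))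
      ≡⟨ ∑-members-split _ G per-collection ⟩
    ∑ (sublists nonMaximal) (λ C → ∑ (sublists maximal) (λ X → G X C))
      ≡⟨ ∑-cong-∈ (sublists nonMaximal) ∑-maximal ⟩
    ∑ (sublists nonMaximal) (λ C → ind (nestedCondᵇ B C) (t ^ (d ∸ length C)))
      ≡⟨ sym fNest-expansion ⟩
    fNest B t ∎)
    where
    open ≡-Reasoning
    G : List (Subset n) → List (Subset n) → ℤ
    G X C = ind (nestedCondᵇ B C) (ind (covers C X) (t ^ (n ∸ (length X ℕ.+ length C))))
    per-collection : ∀ {L} → L ∈ₗ sublists (members B) →
      nestedTerm ((- t - 1ℤ) + (t + 1ℤ)) L ≡ G (filterᵇ isMax L) (filterᵇ (not ∘ isMax) L)
    per-collection {L} L∈ = begin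
      nestedTerm ((- t - 1ℤ) + (t + 1ℤ)) L
        ≡⟨ cong (λ b → ind (nestedCondᵇ B L) (t ^ (∣ ⋃ L ∣ ∸ length L) * b ^ (n ∸ ∣ ⋃ L ∣))) (-t-1+[t+1]≡0 t) ⟩
      ind (nestedCondᵇ B L) (t ^ (∣ ⋃ L ∣ ∸ length L) * 0ℤ ^ (n ∸ ∣ ⋃ L ∣))
        ≡⟨ cong (ind (nestedCondᵇ B L)) (zero-power-selects t (Subsetₚ.∣p∣≤n (⋃ L)) (length L)) ⟩
      ind (nestedCondᵇ B L) (ind (∣ ⋃ L ∣ ≡ᵇ n) (t ^ (n ∸ length L)))
        ≡⟨ cong₂ (λ b U → ind b (ind (∣ U ∣ ≡ᵇ n) (t ^ (n ∸ length L)))) (nestedCond-split L∈) (⋃-partitionᵇ isMax L) ⟩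
      ind (nestedCondᵇ B C) (ind (covers C X) (t ^ (n ∸ length L)))
        ≡⟨ cong (λ ℓ → ind (nestedCondᵇ B C) (ind (covers C X) (t ^ (n ∸ ℓ)))) (length-partitionᵇ isMax L) ⟩
      G X C ∎
      where
      X = filterᵇ isMax L
      C = filterᵇ (not ∘ isMax) L
      -t-1+[t+1]≡0 : ∀ t → (- t - 1ℤ) + (t + 1ℤ) ≡ 0ℤ
      -t-1+[t+1]≡0 = solve-∀
    ∑-maximal : ∀ {C} → C ∈ₗ sublists nonMaximal →
      ∑ (sublists maximal) (λ X → G X C) ≡ ind (nestedCondᵇ B C) (t ^ (d ∸ length C))
    ∑-maximal {C} C∈ = trans (∑-ind (sublists maximal) (nestedCondᵇ B C) _) by-cond
      where
      by-cond : ind (nestedCondᵇ B C)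
                  (∑ (sublists maximal) (λ X → ind (covers C X) (t ^ (n ∸ (length X ℕ.+ length C)))))
                  ≡ ind (nestedCondᵇ B C) (t ^ (d ∸ length C))
      by-cond with nestedCondᵇ B C in C-cond
      ... | false = refl
      ... | true = begin
        ∑ (sublists maximal) (λ X → ind (covers C X) (t ^ (n ∸ (length X ℕ.+ length C))))
          ≡⟨ ∑-covers C∈ C-cond (λ a → t ^ (n ∸ (a ℕ.+ length C))) ⟩
        t ^ (n ∸ (length maximal ℕ.+ length C))
          ≡⟨ cong (t ^_) (sym (ℕₚ.∸-+-assoc n (length maximal) (length C))) ⟩
        t ^ ((n ∸ length maximal) ∸ length C)
          ≡⟨ cong (λ m → t ^ ((n ∸ m) ∸ length C)) length-maximal ⟩
        t ^ (d ∸ length C) ∎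

corollary5p6 : ∀ (n : ℕ) (B : Subset n → Bool) → IsBuildingSet B → ∀ (t : ℤ) →
    (fNest B t ≡ sumℤ (map (λ S → (- t - + 1) ^ (n ∸ ∣ S ∣) * fExt (restrict B S) S t) (allSubsets n)))
    × ((t + + 1) ^ maxCount B * fNest B t
        ≡ sumℤ (map (λ S → (- + 1) ^ (n ∸ ∣ S ∣) * fExt (restrict B S) S t) (allSubsets n)))
corollary5p6 n B isBuildingSet t = identity-signed , identity-unsigned
  where open Expansion B isBuildingSet t
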